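{- For $q\in\mathbb{N}$ and non-negative integers $p,r$ with $p+q>1$, \begin{align*} \sum_{n=r+1}^{\infty}\frac{H_{n}}{(n-r)^{p}\binom{n+q}{q}}&=\binom{r+q}{q}^{ -1}\sum_{n=1}^{\infty}\frac{h_{n}^{(r+1)}}{n^{p}\binom{n+q+r}{n}}\\ &\quad+H_{r}\sum_{a=1}^{q}(-1)^{a}\binom{q}{a}a\left\{\sum_{m=1}^{p-1}\frac{(-1)^{m}}{(r+a)^{m}}\zeta(p+1-m)+\frac{(-1)^{p}}{(r+a)^{p}}H_{r+a}\right\}. \end{align*}
   Context: $H_n=\sum_{i=1}^n 1/i$ ($H_0=0$). Hyperharmonic numbers: $h_n^{(0)}=1/n$, $h_n^{(r)}=\sum_{k=1}^n h_k^{(r-1)}$ for $r\ge1$. $\zeta$ is the Riemann zeta function. -}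

module Defs where

open import Data.Nat as ℕ using (ℕ; zero; suc; _∸_)
open import Data.Nat.Combinatorics using (_C_)
open import Data.Integer using (+_)
open import Data.Rational using (ℚ; 0ℚ; 1ℚ; _+_; _*_; -_; _/_)

fromℕ : ℕ → ℚ
fromℕ n = + n / 1

-- reciprocal of a natural number (inv 0 = 0; never used at 0 below)
inv : ℕ → ℚ
inv zero    = 0ℚ
inv (suc n) = + 1 / suc n

sgn : ℕ → ℚ
sgn zero    = 1ℚ
sgn (suc a) = - sgn a

sumLen : ℕ → ℕ → (ℕ → ℚ) → ℚ
sumLen lo zero    f = 0ℚ
sumLen lo (suc k) f = sumLen lo k f + f (lo ℕ.+ k)

-- Σ_{n=lo}^{hi} f n   (empty if hi < lo)
sumFT : ℕ → ℕ → (ℕ → ℚ) → ℚ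
sumFT lo hi f = sumLen lo (suc hi ∸ lo) f

H : ℕ → ℚ
H n = sumFT 1 n inv

hyper : ℕ → ℕ → ℚ
hyper zero    n = inv n
hyper (suc r) n = sumFT 1 n (hyper r)

zetaPartial : ℕ → ℕ → ℚ
zetaPartial s M = sumFT 1 M (λ k → inv (k ℕ.^ s))

lhsPartial : ℕ → ℕ → ℕ → ℕ → ℚ
lhsPartial q p r M =
  sumFT (suc r) M (λ n → H n * inv (((n ∸ r) ℕ.^ p) ℕ.* ((n ℕ.+ q) C q)))

-- right-hand side with every infinite series truncated at M
rhsPartial : ℕ → ℕ → ℕ → ℕ → ℚ
rhsPartial q p r M =
  inv ((r ℕ.+ q) C q)
    * sumFT 1 M (λ n → hyper (suc r) n * inv ((n ℕ.^ p) ℕ.* ((n ℕ.+ q ℕ.+ r) C n)))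
  + H r * sumFT 1 q (λ a →
      sgn a * fromℕ (q C a) * fromℕ a
        * ( sumFT 1 (p ∸ 1) (λ m → sgn m * inv ((r ℕ.+ a) ℕ.^ m) * zetaPartial (suc p ∸ m) M)
          + sgn p * inv ((r ℕ.+ a) ℕ.^ p) * H (r ℕ.+ a)))

{-# OPTIONS --safe #-}
-- Write M = K + r. Since h_n^(r+1) = C(n+r,r) (H_{n+r} − H_r) and C(r+q,q) C(n+r+q,n) = C(n+r,r) C(n+r+q,q),
-- the first sum on the right is Σ_{n ≤ M} (H_{n+r} − H_r) / (n^p C(n+r+q,q)). Against the left-hand sum
-- Σ_{k ≤ K} H_{k+r} / (k^p C(k+r+q,q)) this leaves H_r Σ_{k ≤ K} 1/(k^p C(k+r+q,q)) and r tail terms, each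
-- O(1/K) because p + q ≥ 2. The partial fractions 1/C(x+q,q) = −Σ_a (−1)^a C(q,a) a / (x+a), followed by the
-- expansion of 1/(k^p (k+c)) in powers of 1/c, turn that sum into the bracketed sum over a, up to differences
-- of partial sums of ζ and H between K and K + r, again O(1/K). For p = 0 stray H_K terms remain; they cancel
-- because Σ_a (−1)^a C(q,a) a = 0 for q ≥ 2.
module Submission where

open import Defs
open import Data.Nat as ℕ using (ℕ; zero; suc; _∸_; _!; _^_)
import Data.Nat.Properties as ℕP
open import Data.Nat.Combinatorics using (_C_)
import Data.Nat.Combinatorics as ℕC
import Data.Nat.DivMod as ℕD
import Data.Nat.Coprimality as Coprime
import Data.Nat.Solver as ℕSolver
import Data.Integer as ℤ
import Data.Integer.Properties as ℤP
open import Data.Rational using (ℚ; mkℚ; 0ℚ; 1ℚ; _+_; _*_; -_; _-_; _/_; ∣_∣; _≤_; _<_; *≤*)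
import Data.Rational as ℚ
import Data.Rational.Properties as ℚP
import Data.Rational.Unnormalised as ℚᵘ
import Data.Rational.Unnormalised.Properties as ℚᵘP
open import Data.Rational.Solver using (module +-*-Solver)
open import Data.Product using (∃; _,_)
open import Data.Empty using (⊥-elim)
open import Relation.Binary.PropositionalEquality

open +-*-Solver
module ℕS = ℕSolver.+-*-Solver

-- Natural numbers and their reciprocals in ℚ
toℚᵘ-/ : ∀ i d → ℚ.toℚᵘ (i / suc d) ℚᵘ.≃ ℚᵘ.mkℚᵘ i d
toℚᵘ-/ i d = ℚP.toℚᵘ-fromℚᵘ (ℚᵘ.mkℚᵘ i d)

cross⇒/≡ : ∀ i j d e → i ℤ.* ℤ.+ suc e ≡ j ℤ.* ℤ.+ suc d → i / suc d ≡ j / suc e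
cross⇒/≡ i j d e eq = ℚP.toℚᵘ-injective
  (ℚᵘP.≃-trans (toℚᵘ-/ i d) (ℚᵘP.≃-trans (ℚᵘ.*≡* eq) (ℚᵘP.≃-sym (toℚᵘ-/ j e))))

cross⇒/≤ : ∀ i j d e → i ℤ.* ℤ.+ suc e ℤ.≤ j ℤ.* ℤ.+ suc d → i / suc d ≤ j / suc e
cross⇒/≤ i j d e h = ℚP.toℚᵘ-cancel-≤
  (ℚᵘP.≤-respˡ-≃ (ℚᵘP.≃-sym (toℚᵘ-/ i d)) (ℚᵘP.≤-respʳ-≃ (ℚᵘP.≃-sym (toℚᵘ-/ j e)) (ℚᵘ.*≤* h)))

cross⇒/< : ∀ i j d e → i ℤ.* ℤ.+ suc e ℤ.< j ℤ.* ℤ.+ suc d → i / suc d < j / suc e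
cross⇒/< i j d e h = ℚP.toℚᵘ-cancel-<
  (ℚᵘP.<-respˡ-≃ (ℚᵘP.≃-sym (toℚᵘ-/ i d)) (ℚᵘP.<-respʳ-≃ (ℚᵘP.≃-sym (toℚᵘ-/ j e)) (ℚᵘ.*<* h)))

fromℕ≡mkℚ : ∀ m → fromℕ m ≡ mkℚ (ℤ.+ m) 0 (Coprime.sym (Coprime.1-coprimeTo m))
fromℕ≡mkℚ m = ℚP.normalize-coprime (Coprime.sym (Coprime.1-coprimeTo m))

inv-suc≡mkℚ : ∀ n → inv (suc n) ≡ mkℚ (ℤ.+ 1) n (Coprime.1-coprimeTo (suc n))
inv-suc≡mkℚ n = ℚP.normalize-coprime (Coprime.1-coprimeTo (suc n))

fromℕ-homo-+ : ∀ m n → fromℕ (m ℕ.+ n) ≡ fromℕ m + fromℕ n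
fromℕ-homo-+ m n rewrite fromℕ≡mkℚ m | fromℕ≡mkℚ n =
  cross⇒/≡ (ℤ.+ (m ℕ.+ n)) (ℤ.+ m ℤ.* ℤ.+ 1 ℤ.+ ℤ.+ n ℤ.* ℤ.+ 1) 0 0 (cong (ℤ._* ℤ.+ 1)
    (trans (ℤP.pos-+ m n) (sym (cong₂ ℤ._+_ (ℤP.*-identityʳ (ℤ.+ m)) (ℤP.*-identityʳ (ℤ.+ n))))))

fromℕ-homo-* : ∀ m n → fromℕ (m ℕ.* n) ≡ fromℕ m * fromℕ n
fromℕ-homo-* m n rewrite fromℕ≡mkℚ m | fromℕ≡mkℚ n =
  cross⇒/≡ (ℤ.+ (m ℕ.* n)) (ℤ.+ m ℤ.* ℤ.+ n) 0 0 (cong (ℤ._* ℤ.+ 1) (ℤP.pos-* m n))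

inv-homo-* : ∀ m n → inv (m ℕ.* n) ≡ inv m * inv n
inv-homo-* zero n = sym (ℚP.*-zeroˡ (inv n))
inv-homo-* (suc m) zero rewrite ℕP.*-zeroʳ m = sym (ℚP.*-zeroʳ (inv (suc m)))
inv-homo-* (suc m) (suc n) rewrite inv-suc≡mkℚ m | inv-suc≡mkℚ n =
  cross⇒/≡ (ℤ.+ 1) (ℤ.+ 1 ℤ.* ℤ.+ 1) (n ℕ.+ m ℕ.* suc n) (n ℕ.+ m ℕ.* suc n) refl

fromℕ*inv≡1 : ∀ n → 1 ℕ.≤ n → fromℕ n * inv n ≡ 1ℚ
fromℕ*inv≡1 (suc n) _ rewrite fromℕ≡mkℚ (suc n) | inv-suc≡mkℚ n =
  cross⇒/≡ (ℤ.+ suc n ℤ.* ℤ.+ 1) (ℤ.+ 1) (n ℕ.+ 0 ℕ.* suc n) 0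
    (trans (ℤP.*-identityʳ _) (trans (ℤP.*-identityʳ _)
      (sym (trans (ℤP.*-identityˡ _) (cong (λ x → ℤ.+ suc x) (ℕP.+-identityʳ n))))))

inv*fromℕ≡1 : ∀ n → 1 ℕ.≤ n → inv n * fromℕ n ≡ 1ℚ
inv*fromℕ≡1 n h = trans (ℚP.*-comm (inv n) (fromℕ n)) (fromℕ*inv≡1 n h)

fromℕ*inv-suc≡/ : ∀ y x → fromℕ y * inv (suc x) ≡ ℤ.+ y / suc x
fromℕ*inv-suc≡/ y x rewrite fromℕ≡mkℚ y | inv-suc≡mkℚ x =
  cross⇒/≡ (ℤ.+ y ℤ.* ℤ.+ 1) (ℤ.+ y) (x ℕ.+ 0 ℕ.* suc x) x
    (cong₂ ℤ._*_ (ℤP.*-identityʳ (ℤ.+ y)) (cong (λ t → ℤ.+ suc t) (sym (ℕP.+-identityʳ x))))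

*-fromℕ-cancelʳ : ∀ a b x → 1 ℕ.≤ x → a * fromℕ x ≡ b * fromℕ x → a ≡ b
*-fromℕ-cancelʳ a b x h eq = begin
  a                      ≡⟨ sym (ℚP.*-identityʳ a) ⟩
  a * 1ℚ                 ≡⟨ cong (a *_) (sym (fromℕ*inv≡1 x h)) ⟩
  a * (fromℕ x * inv x)  ≡⟨ sym (ℚP.*-assoc a _ _) ⟩
  a * fromℕ x * inv x    ≡⟨ cong (_* inv x) eq ⟩
  b * fromℕ x * inv x    ≡⟨ ℚP.*-assoc b _ _ ⟩
  b * (fromℕ x * inv x)  ≡⟨ cong (b *_) (fromℕ*inv≡1 x h) ⟩
  b * 1ℚ                 ≡⟨ ℚP.*-identityʳ b ⟩
  b                      ∎
  where open ≡-Reasoning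

fromℕ*inv-cross : ∀ y x y′ x′ → 1 ℕ.≤ x → 1 ℕ.≤ x′ → y ℕ.* x′ ≡ y′ ℕ.* x →
  fromℕ y * inv x ≡ fromℕ y′ * inv x′
fromℕ*inv-cross y x y′ x′ hx hx′ eq = *-fromℕ-cancelʳ _ _ x hx (*-fromℕ-cancelʳ _ _ x′ hx′ (begin
  fromℕ y * inv x * fromℕ x * fromℕ x′
    ≡⟨ solve 4 (λ a b c d → a :* b :* c :* d := (a :* d) :* (b :* c)) refl (fromℕ y) (inv x) (fromℕ x) (fromℕ x′) ⟩
  (fromℕ y * fromℕ x′) * (inv x * fromℕ x)
    ≡⟨ cong₂ _*_ (trans (sym (fromℕ-homo-* y x′)) (trans (cong fromℕ eq) (fromℕ-homo-* y′ x))) (inv*fromℕ≡1 x hx) ⟩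
  (fromℕ y′ * fromℕ x) * 1ℚ
    ≡⟨ cong ((fromℕ y′ * fromℕ x) *_) (sym (inv*fromℕ≡1 x′ hx′)) ⟩
  (fromℕ y′ * fromℕ x) * (inv x′ * fromℕ x′)
    ≡⟨ solve 4 (λ a b c d → (a :* b) :* (c :* d) := a :* c :* b :* d) refl (fromℕ y′) (fromℕ x) (inv x′) (fromℕ x′) ⟩
  fromℕ y′ * inv x′ * fromℕ x * fromℕ x′ ∎))
  where open ≡-Reasoning

inv*fromℕ*inv≡inv : ∀ x y z w → 1 ℕ.≤ x → 1 ℕ.≤ z → 1 ℕ.≤ w → y ℕ.* w ≡ x ℕ.* z →
  inv x * fromℕ y * inv z ≡ inv w
inv*fromℕ*inv≡inv x y z w hx hz hw eq = *-fromℕ-cancelʳ _ _ w hw (begin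
  inv x * fromℕ y * inv z * fromℕ w
    ≡⟨ solve 4 (λ a b c d → a :* b :* c :* d := (a :* c) :* (b :* d)) refl (inv x) (fromℕ y) (inv z) (fromℕ w) ⟩
  (inv x * inv z) * (fromℕ y * fromℕ w)
    ≡⟨ cong ((inv x * inv z) *_) (trans (sym (fromℕ-homo-* y w)) (trans (cong fromℕ eq) (fromℕ-homo-* x z))) ⟩
  (inv x * inv z) * (fromℕ x * fromℕ z)
    ≡⟨ solve 4 (λ a b c d → (a :* b) :* (c :* d) := (a :* c) :* (b :* d)) refl (inv x) (inv z) (fromℕ x) (fromℕ z) ⟩
  (inv x * fromℕ x) * (inv z * fromℕ z)
    ≡⟨ cong₂ _*_ (inv*fromℕ≡1 x hx) (inv*fromℕ≡1 z hz) ⟩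
  1ℚ * 1ℚ
    ≡⟨ sym (inv*fromℕ≡1 w hw) ⟩
  inv w * fromℕ w ∎)
  where open ≡-Reasoning

*-mono-≤-nonNeg : ∀ {a b c d} → 0ℚ ≤ a → 0ℚ ≤ c → a ≤ b → c ≤ d → a * c ≤ b * d
*-mono-≤-nonNeg {a} {b} {c} {d} 0≤a 0≤c a≤b c≤d =
  ℚP.≤-trans (ℚP.*-monoʳ-≤-nonNeg c {{ℚ.nonNegative 0≤c}} a≤b)
             (ℚP.*-monoˡ-≤-nonNeg b {{ℚ.nonNegative (ℚP.≤-trans 0≤a a≤b)}} c≤d)

0≤* : ∀ {a c} → 0ℚ ≤ a → 0ℚ ≤ c → 0ℚ ≤ a * c
0≤* {a} {c} 0≤a 0≤c = subst (_≤ a * c) (ℚP.*-zeroˡ c) (ℚP.*-monoʳ-≤-nonNeg c {{ℚ.nonNegative 0≤c}} 0≤a)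

fromℕ-mono-≤ : ∀ {m n} → m ℕ.≤ n → fromℕ m ≤ fromℕ n
fromℕ-mono-≤ {m} {n} m≤n rewrite fromℕ≡mkℚ m | fromℕ≡mkℚ n =
  *≤* (ℤP.*-monoʳ-≤-nonNeg (ℤ.+ 1) (ℤ.+≤+ m≤n))

0≤fromℕ : ∀ n → 0ℚ ≤ fromℕ n
0≤fromℕ n = fromℕ-mono-≤ {0} {n} ℕ.z≤n

fromℕ*inv-mono-≤ : ∀ y x y′ x′ → 1 ℕ.≤ x → 1 ℕ.≤ x′ → y ℕ.* x′ ℕ.≤ y′ ℕ.* x →
  fromℕ y * inv x ≤ fromℕ y′ * inv x′
fromℕ*inv-mono-≤ y (suc x) y′ (suc x′) _ _ h rewrite fromℕ*inv-suc≡/ y x | fromℕ*inv-suc≡/ y′ x′ =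
  cross⇒/≤ (ℤ.+ y) (ℤ.+ y′) x x′ (subst₂ ℤ._≤_ (ℤP.pos-* y (suc x′)) (ℤP.pos-* y′ (suc x)) (ℤ.+≤+ h))

inv-antimono-≤ : ∀ {m n} → 1 ℕ.≤ m → m ℕ.≤ n → inv n ≤ inv m
inv-antimono-≤ {suc m} {suc n} _ m≤n rewrite inv-suc≡mkℚ m | inv-suc≡mkℚ n =
  *≤* (ℤP.*-monoˡ-≤-nonNeg (ℤ.+ 1) (ℤ.+≤+ m≤n))

0≤inv : ∀ n → 0ℚ ≤ inv n
0≤inv zero    = ℚP.≤-refl
0≤inv (suc n) rewrite inv-suc≡mkℚ n = *≤* (ℤ.+≤+ ℕ.z≤n)

inv≤1 : ∀ n → inv n ≤ 1ℚ
inv≤1 zero    = *≤* (ℤ.+≤+ ℕ.z≤n)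
inv≤1 (suc n) = inv-antimono-≤ {1} {suc n} (ℕ.s≤s ℕ.z≤n) (ℕ.s≤s ℕ.z≤n)

∣inv∣≤1 : ∀ n → ∣ inv n ∣ ≤ 1ℚ
∣inv∣≤1 n = subst (_≤ 1ℚ) (sym (ℚP.0≤p⇒∣p∣≡p (0≤inv n))) (inv≤1 n)

∣sgn∣≡1 : ∀ m → ∣ sgn m ∣ ≡ 1ℚ
∣sgn∣≡1 zero    = refl
∣sgn∣≡1 (suc m) = trans (ℚP.∣-p∣≡∣p∣ (sgn m)) (∣sgn∣≡1 m)

-- Finite sums
sumLen-cong : ∀ lo n {f g : ℕ → ℚ} → (∀ j → j ℕ.< n → f (lo ℕ.+ j) ≡ g (lo ℕ.+ j)) →
  sumLen lo n f ≡ sumLen lo n g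
sumLen-cong lo zero    h = refl
sumLen-cong lo (suc n) h = cong₂ _+_ (sumLen-cong lo n (λ j j<n → h j (ℕP.m<n⇒m<1+n j<n))) (h n ℕP.≤-refl)

sumLen-cong′ : ∀ lo n {f g : ℕ → ℚ} → (∀ i → f i ≡ g i) → sumLen lo n f ≡ sumLen lo n g
sumLen-cong′ lo n h = sumLen-cong lo n (λ j _ → h (lo ℕ.+ j))

sumLen-0 : ∀ lo n → sumLen lo n (λ _ → 0ℚ) ≡ 0ℚ
sumLen-0 lo zero = refl
sumLen-0 lo (suc n) rewrite sumLen-0 lo n = refl

sumLen-+ : ∀ lo n (f g : ℕ → ℚ) → sumLen lo n (λ i → f i + g i) ≡ sumLen lo n f + sumLen lo n g
sumLen-+ lo zero    f g = refl
sumLen-+ lo (suc n) f g rewrite sumLen-+ lo n f g =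
  solve 4 (λ a b c d → (a :+ b) :+ (c :+ d) := (a :+ c) :+ (b :+ d)) refl
    (sumLen lo n f) (sumLen lo n g) (f (lo ℕ.+ n)) (g (lo ℕ.+ n))

sumLen-*ˡ : ∀ lo n a (f : ℕ → ℚ) → sumLen lo n (λ i → a * f i) ≡ a * sumLen lo n f
sumLen-*ˡ lo zero    a f = sym (ℚP.*-zeroʳ a)
sumLen-*ˡ lo (suc n) a f rewrite sumLen-*ˡ lo n a f = sym (ℚP.*-distribˡ-+ a (sumLen lo n f) (f (lo ℕ.+ n)))

sumLen-*ʳ : ∀ lo n a (f : ℕ → ℚ) → sumLen lo n (λ i → f i * a) ≡ sumLen lo n f * a
sumLen-*ʳ lo n a f =
  trans (sumLen-cong′ lo n (λ i → ℚP.*-comm (f i) a)) (trans (sumLen-*ˡ lo n a f) (ℚP.*-comm a _))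

sumLen-neg : ∀ lo n (f : ℕ → ℚ) → sumLen lo n (λ i → - f i) ≡ - sumLen lo n f
sumLen-neg lo zero    f = refl
sumLen-neg lo (suc n) f rewrite sumLen-neg lo n f = sym (ℚP.neg-distrib-+ (sumLen lo n f) (f (lo ℕ.+ n)))

sumLen-- : ∀ lo n (f g : ℕ → ℚ) → sumLen lo n (λ i → f i - g i) ≡ sumLen lo n f - sumLen lo n g
sumLen-- lo n f g = trans (sumLen-+ lo n f (λ i → - g i)) (cong (sumLen lo n f +_) (sumLen-neg lo n g))

sumLen-++ : ∀ lo m n (f : ℕ → ℚ) → sumLen lo (m ℕ.+ n) f ≡ sumLen lo m f + sumLen (lo ℕ.+ m) n f
sumLen-++ lo m zero    f rewrite ℕP.+-identityʳ m = sym (ℚP.+-identityʳ _)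
sumLen-++ lo m (suc n) f rewrite ℕP.+-suc m n | sumLen-++ lo m n f | ℕP.+-assoc lo m n =
  ℚP.+-assoc (sumLen lo m f) _ _

sumLen-shift : ∀ lo s n (f : ℕ → ℚ) → sumLen (lo ℕ.+ s) n f ≡ sumLen lo n (λ i → f (i ℕ.+ s))
sumLen-shift lo s zero    f = refl
sumLen-shift lo s (suc n) f rewrite sumLen-shift lo s n f =
  cong (sumLen lo n (λ i → f (i ℕ.+ s)) +_) (cong f (begin
    lo ℕ.+ s ℕ.+ n   ≡⟨ ℕP.+-assoc lo s n ⟩
    lo ℕ.+ (s ℕ.+ n) ≡⟨ cong (lo ℕ.+_) (ℕP.+-comm s n) ⟩
    lo ℕ.+ (n ℕ.+ s) ≡⟨ sym (ℕP.+-assoc lo n s) ⟩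
    lo ℕ.+ n ℕ.+ s   ∎))
  where open ≡-Reasoning

sumLen-suc : ∀ n (g : ℕ → ℚ) → sumLen 1 n g ≡ sumLen 0 n (λ j → g (suc j))
sumLen-suc n g = trans (sumLen-shift 0 1 n g) (sumLen-cong′ 0 n (λ j → cong g (ℕP.+-comm j 1)))

sumLen-head : ∀ lo n (f : ℕ → ℚ) → sumLen lo (suc n) f ≡ f lo + sumLen (suc lo) n f
sumLen-head lo n f = trans (sumLen-++ lo 1 n f)
  (cong₂ _+_ (trans (ℚP.+-identityˡ _) (cong f (ℕP.+-identityʳ lo))) (cong (λ x → sumLen x n f) (ℕP.+-comm lo 1)))

sumLen-comm : ∀ a n b m (f : ℕ → ℕ → ℚ) →
  sumLen a n (λ i → sumLen b m (f i)) ≡ sumLen b m (λ j → sumLen a n (λ i → f i j))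
sumLen-comm a zero    b m f = sym (sumLen-0 b m)
sumLen-comm a (suc n) b m f rewrite sumLen-comm a n b m f =
  sym (sumLen-+ b m (λ j → sumLen a n (λ i → f i j)) (f (a ℕ.+ n)))

sumLen-const : ∀ lo n c → sumLen lo n (λ _ → c) ≡ fromℕ n * c
sumLen-const lo zero    c = sym (ℚP.*-zeroˡ c)
sumLen-const lo (suc n) c rewrite sumLen-const lo n c | fromℕ-homo-+ 1 n | ℚP.*-distribʳ-+ c 1ℚ (fromℕ n) =
  trans (ℚP.+-comm _ c) (cong (_+ fromℕ n * c) (sym (ℚP.*-identityˡ c)))

sumLen-mono-≤ : ∀ lo n {f g : ℕ → ℚ} → (∀ j → j ℕ.< n → f (lo ℕ.+ j) ≤ g (lo ℕ.+ j)) →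
  sumLen lo n f ≤ sumLen lo n g
sumLen-mono-≤ lo zero    h = ℚP.≤-refl
sumLen-mono-≤ lo (suc n) h = ℚP.+-mono-≤ (sumLen-mono-≤ lo n (λ j j<n → h j (ℕP.m<n⇒m<1+n j<n))) (h n ℕP.≤-refl)

sumLen-nonNeg : ∀ lo n (f : ℕ → ℚ) → (∀ j → j ℕ.< n → 0ℚ ≤ f (lo ℕ.+ j)) → 0ℚ ≤ sumLen lo n f
sumLen-nonNeg lo n f h = subst (_≤ sumLen lo n f) (sumLen-0 lo n) (sumLen-mono-≤ lo n h)

∣sumLen∣≤sumLen∣∣ : ∀ lo n (f : ℕ → ℚ) → ∣ sumLen lo n f ∣ ≤ sumLen lo n (λ i → ∣ f i ∣)
∣sumLen∣≤sumLen∣∣ lo zero    f = ℚP.≤-refl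
∣sumLen∣≤sumLen∣∣ lo (suc n) f = ℚP.≤-trans (ℚP.∣p+q∣≤∣p∣+∣q∣ (sumLen lo n f) (f (lo ℕ.+ n)))
  (ℚP.+-monoˡ-≤ ∣ f (lo ℕ.+ n) ∣ (∣sumLen∣≤sumLen∣∣ lo n f))

∣sumLen∣≤length* : ∀ lo n (f : ℕ → ℚ) b → (∀ j → j ℕ.< n → ∣ f (lo ℕ.+ j) ∣ ≤ b) →
  ∣ sumLen lo n f ∣ ≤ fromℕ n * b
∣sumLen∣≤length* lo n f b h = ℚP.≤-trans (∣sumLen∣≤sumLen∣∣ lo n f)
  (subst (sumLen lo n (λ i → ∣ f i ∣) ≤_) (sumLen-const lo n b) (sumLen-mono-≤ lo n h))

H-+ : ∀ c K → H (c ℕ.+ K) ≡ H c + sumLen 1 K (λ k → inv (k ℕ.+ c))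
H-+ c K = trans (sumLen-++ 1 c K inv) (cong (H c +_) (sumLen-shift 1 c K inv))

0≤H : ∀ n → 0ℚ ≤ H n
0≤H n = sumLen-nonNeg 1 n inv (λ j _ → 0≤inv (suc j))

H≤fromℕ : ∀ n → H n ≤ fromℕ n
H≤fromℕ zero    = ℚP.≤-refl
H≤fromℕ (suc n) = subst (H (suc n) ≤_) (trans (ℚP.+-comm (fromℕ n) 1ℚ) (sym (fromℕ-homo-+ 1 n)))
  (ℚP.+-mono-≤ (H≤fromℕ n) (inv≤1 (suc n)))

-- Binomial coefficients
C*k!*[n∸k]!≡n! : ∀ {n k} → k ℕ.≤ n → (n C k) ℕ.* (k ! ℕ.* (n ∸ k) !) ≡ n !
C*k!*[n∸k]!≡n! {n} {k} k≤n rewrite ℕC.nCk≡n!/k![n-k]! k≤n =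
  ℕD.m/n*n≡m {{ℕP._!*_!≢0 k (n ∸ k)}} (ℕC.k![n∸k]!∣n! k≤n)

1≤C : ∀ {n k} → k ℕ.≤ n → 1 ℕ.≤ n C k
1≤C {n} {k} k≤n with n C k | C*k!*[n∸k]!≡n! k≤n
... | zero  | 0≡n! = ⊥-elim (ℕP.<⇒≢ (ℕP.1≤n! n) 0≡n!)
... | suc _ | _    = ℕ.s≤s ℕ.z≤n

C-pascal : ∀ n k → suc n C suc k ≡ n C k ℕ.+ n C suc k
C-pascal n k = sym (ℕC.nCk+nC[k+1]≡[n+1]C[k+1] n k)

C-absorption : ∀ m r → r ℕ.≤ m → suc r ℕ.* (suc m C suc r) ≡ suc m ℕ.* (m C r)
C-absorption m r r≤m = ℕP.*-cancelʳ-≡ _ _ (r ! ℕ.* (m ∸ r) !) {{ℕP._!*_!≢0 r (m ∸ r)}} (begin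
  suc r ℕ.* (suc m C suc r) ℕ.* (r ! ℕ.* (m ∸ r) !)
    ≡⟨ ℕS.solve 4 (λ a b c d → a ℕS.:* b ℕS.:* (c ℕS.:* d) ℕS.:= b ℕS.:* (a ℕS.:* c ℕS.:* d)) refl (suc r) (suc m C suc r) (r !) ((m ∸ r) !) ⟩
  (suc m C suc r) ℕ.* (suc r ! ℕ.* (suc m ∸ suc r) !)
    ≡⟨ C*k!*[n∸k]!≡n! (ℕ.s≤s r≤m) ⟩
  suc m !
    ≡⟨ cong (suc m ℕ.*_) (sym (C*k!*[n∸k]!≡n! r≤m)) ⟩
  suc m ℕ.* ((m C r) ℕ.* (r ! ℕ.* (m ∸ r) !))
    ≡⟨ sym (ℕP.*-assoc (suc m) (m C r) _) ⟩
  suc m ℕ.* (m C r) ℕ.* (r ! ℕ.* (m ∸ r) !) ∎)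
  where open ≡-Reasoning

C-trinomial : ∀ k r q → ((k ℕ.+ r) C r) ℕ.* ((k ℕ.+ r ℕ.+ q) C q) ≡ ((r ℕ.+ q) C q) ℕ.* ((k ℕ.+ r ℕ.+ q) C k)
C-trinomial k r q = ℕP.*-cancelʳ-≡ _ _ F {{F≢0}} (begin
  A ℕ.* B ℕ.* F
    ≡⟨ ℕS.solve 7 (λ a b r! k! q! kr! rq! →
                      a ℕS.:* b ℕS.:* (r! ℕS.:* k! ℕS.:* q! ℕS.:* kr! ℕS.:* rq!)
                 ℕS.:= (a ℕS.:* (r! ℕS.:* k!)) ℕS.:* (b ℕS.:* (q! ℕS.:* kr!)) ℕS.:* rq!)
         refl A B (r !) (k !) (q !) ((k ℕ.+ r) !) ((r ℕ.+ q) !) ⟩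
  (A ℕ.* (r ! ℕ.* k !)) ℕ.* (B ℕ.* (q ! ℕ.* (k ℕ.+ r) !)) ℕ.* (r ℕ.+ q) !
    ≡⟨ cong₂ (λ u v → u ℕ.* v ℕ.* (r ℕ.+ q) !) A-fact B-fact ⟩
  (k ℕ.+ r) ! ℕ.* s ! ℕ.* (r ℕ.+ q) !
    ≡⟨ ℕS.solve 3 (λ x y z → x ℕS.:* y ℕS.:* z ℕS.:= z ℕS.:* y ℕS.:* x) refl ((k ℕ.+ r) !) (s !) ((r ℕ.+ q) !) ⟩
  (r ℕ.+ q) ! ℕ.* s ! ℕ.* (k ℕ.+ r) !
    ≡⟨ sym (cong₂ (λ u v → u ℕ.* v ℕ.* (k ℕ.+ r) !) E-fact D-fact) ⟩
  (E ℕ.* (q ! ℕ.* r !)) ℕ.* (D ℕ.* (k ! ℕ.* (r ℕ.+ q) !)) ℕ.* (k ℕ.+ r) !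
    ≡⟨ ℕS.solve 7 (λ c d r! k! q! kr! rq! →
                      (c ℕS.:* (q! ℕS.:* r!)) ℕS.:* (d ℕS.:* (k! ℕS.:* rq!)) ℕS.:* kr!
                 ℕS.:= c ℕS.:* d ℕS.:* (r! ℕS.:* k! ℕS.:* q! ℕS.:* kr! ℕS.:* rq!))
         refl E D (r !) (k !) (q !) ((k ℕ.+ r) !) ((r ℕ.+ q) !) ⟩
  E ℕ.* D ℕ.* F ∎)
  where
  open ≡-Reasoning
  s = k ℕ.+ r ℕ.+ q
  A = (k ℕ.+ r) C r
  B = s C q
  E = (r ℕ.+ q) C q
  D = s C k
  F = r ! ℕ.* k ! ℕ.* q ! ℕ.* (k ℕ.+ r) ! ℕ.* (r ℕ.+ q) !
  F≢0 : ℕ.NonZero F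
  F≢0 = ℕ.>-nonZero (ℕP.*-mono-≤ (ℕP.*-mono-≤ (ℕP.*-mono-≤ (ℕP.*-mono-≤
          (ℕP.1≤n! r) (ℕP.1≤n! k)) (ℕP.1≤n! q)) (ℕP.1≤n! (k ℕ.+ r))) (ℕP.1≤n! (r ℕ.+ q)))
  fact : ∀ a b → ((a ℕ.+ b) C b) ℕ.* (b ! ℕ.* a !) ≡ (a ℕ.+ b) !
  fact a b = subst (λ t → ((a ℕ.+ b) C b) ℕ.* (b ! ℕ.* t !) ≡ (a ℕ.+ b) !) (ℕP.m+n∸n≡m a b) (C*k!*[n∸k]!≡n! (ℕP.m≤n+m b a))
  A-fact : A ℕ.* (r ! ℕ.* k !) ≡ (k ℕ.+ r) !
  A-fact = fact k r
  B-fact : B ℕ.* (q ! ℕ.* (k ℕ.+ r) !) ≡ s !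
  B-fact = fact (k ℕ.+ r) q
  E-fact : E ℕ.* (q ! ℕ.* r !) ≡ (r ℕ.+ q) !
  E-fact = fact r q
  D-fact : D ℕ.* (k ! ℕ.* (r ℕ.+ q) !) ≡ s !
  D-fact = subst (λ t → D ℕ.* (k ! ℕ.* t !) ≡ s !) s∸k≡r+q (C*k!*[n∸k]!≡n! k≤s)
    where
    s∸k≡r+q : s ∸ k ≡ r ℕ.+ q
    s∸k≡r+q = trans (cong (_∸ k) (ℕP.+-assoc k r q)) (ℕP.m+n∸m≡n k (r ℕ.+ q))
    k≤s : k ℕ.≤ s
    k≤s = subst (k ℕ.≤_) (sym (ℕP.+-assoc k r q)) (ℕP.m≤m+n k (r ℕ.+ q))

-- Hyperharmonic numbers
C*[H-H]-pascal : ∀ m r → r ℕ.≤ suc m →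
  fromℕ (suc (suc m) C suc r) * (H (suc (suc m)) - H (suc r))
    ≡ fromℕ (suc m C suc r) * (H (suc m) - H (suc r)) + fromℕ (suc m C r) * (H (suc m) - H r)
C*[H-H]-pascal m r r≤ = begin
  fromℕ (suc (suc m) C suc r) * (H (suc (suc m)) - H (suc r))
    ≡⟨ cong (λ t → fromℕ t * (X + im - (h + ir))) (C-pascal (suc m) r) ⟩
  fromℕ ((suc m C r) ℕ.+ (suc m C suc r)) * (X + im - (h + ir))
    ≡⟨ cong (λ t → t * (X + im - (h + ir))) (fromℕ-homo-+ (suc m C r) (suc m C suc r)) ⟩
  (a + b) * (X + im - (h + ir))
    ≡⟨ solve 6 (λ a b X im h ir → (a :+ b) :* (X :+ im :- (h :+ ir)) := b :* (X :- (h :+ ir)) :+ a :* (X :- h) :+ ((a :+ b) :* im :- a :* ir)) refl a b X im h ir ⟩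
  b * (X - (h + ir)) + a * (X - h) + ((a + b) * im - a * ir)
    ≡⟨ cong (λ t → b * (X - (h + ir)) + a * (X - h) + (t - a * ir)) absorbed ⟩
  b * (X - (h + ir)) + a * (X - h) + (a * ir - a * ir)
    ≡⟨ solve 5 (λ a b X h ir → b :* (X :- (h :+ ir)) :+ a :* (X :- h) :+ (a :* ir :- a :* ir) := b :* (X :- (h :+ ir)) :+ a :* (X :- h)) refl a b X h ir ⟩
  b * (X - (h + ir)) + a * (X - h) ∎
  where
  open ≡-Reasoning
  a = fromℕ (suc m C r)
  b = fromℕ (suc m C suc r)
  X = H (suc m)
  im = inv (suc (suc m))
  h = H r
  ir = inv (suc r)
  absorbed : (a + b) * im ≡ a * ir
  absorbed = trans (cong (_* im) (sym (fromℕ-homo-+ (suc m C r) (suc m C suc r))))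
    (trans (cong (λ t → fromℕ t * im) (sym (C-pascal (suc m) r)))
      (fromℕ*inv-cross (suc (suc m) C suc r) (suc (suc m)) (suc m C r) (suc r) (ℕ.s≤s ℕ.z≤n) (ℕ.s≤s ℕ.z≤n)
        (trans (ℕP.*-comm (suc (suc m) C suc r) (suc r))
          (trans (C-absorption (suc m) r r≤) (ℕP.*-comm (suc (suc m)) (suc m C r))))))

hyper-suc≡C*[H-H] : ∀ r n → hyper (suc r) n ≡ fromℕ ((n ℕ.+ r) C r) * (H (n ℕ.+ r) - H r)
hyper-suc≡C*[H-H] zero n rewrite ℕP.+-identityʳ n = sym (trans (ℚP.*-identityˡ _) (ℚP.+-identityʳ (H n)))
hyper-suc≡C*[H-H] (suc r) zero =
  sym (trans (cong (fromℕ (suc r C suc r) *_) (ℚP.+-inverseʳ (H (suc r)))) (ℚP.*-zeroʳ (fromℕ (suc r C suc r))))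
hyper-suc≡C*[H-H] (suc r) (suc n) = begin
  hyper (suc (suc r)) n + hyper (suc r) (suc n)
    ≡⟨ cong₂ _+_ (hyper-suc≡C*[H-H] (suc r) n) (hyper-suc≡C*[H-H] r (suc n)) ⟩
  fromℕ ((n ℕ.+ suc r) C suc r) * (H (n ℕ.+ suc r) - H (suc r)) + fromℕ ((suc n ℕ.+ r) C r) * (H (suc n ℕ.+ r) - H r)
    ≡⟨ cong (λ t → fromℕ (t C suc r) * (H t - H (suc r)) + fromℕ ((suc n ℕ.+ r) C r) * (H (suc n ℕ.+ r) - H r)) (ℕP.+-suc n r) ⟩
  fromℕ (suc (n ℕ.+ r) C suc r) * (H (suc (n ℕ.+ r)) - H (suc r)) + fromℕ (suc (n ℕ.+ r) C r) * (H (suc (n ℕ.+ r)) - H r)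
    ≡⟨ sym (C*[H-H]-pascal (n ℕ.+ r) r (ℕP.m≤n⇒m≤1+n (ℕP.m≤n+m r n))) ⟩
  fromℕ (suc (suc (n ℕ.+ r)) C suc r) * (H (suc (suc (n ℕ.+ r))) - H (suc r))
    ≡⟨ cong (λ t → fromℕ (suc t C suc r) * (H (suc t) - H (suc r))) (sym (ℕP.+-suc n r)) ⟩
  fromℕ ((suc n ℕ.+ suc r) C suc r) * (H (suc n ℕ.+ suc r) - H (suc r)) ∎
  where open ≡-Reasoning

denominator : ℕ → ℕ → ℕ → ℕ → ℕ
denominator q p r k = (k ^ p) ℕ.* ((k ℕ.+ r ℕ.+ q) C q)

reducedSummand : ℕ → ℕ → ℕ → ℕ → ℚ
reducedSummand q p r k = (H (k ℕ.+ r) - H r) * inv (denominator q p r k)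

hyperSummand≡reducedSummand : ∀ q p r k →
  inv ((r ℕ.+ q) C q) * (hyper (suc r) k * inv ((k ^ p) ℕ.* ((k ℕ.+ q ℕ.+ r) C k))) ≡ reducedSummand q p r k
hyperSummand≡reducedSummand q p r k
  rewrite hyper-suc≡C*[H-H] r k | inv-homo-* (k ^ p) ((k ℕ.+ q ℕ.+ r) C k)
        | inv-homo-* (k ^ p) ((k ℕ.+ r ℕ.+ q) C q)
        | trans (ℕP.+-assoc k q r) (trans (cong (k ℕ.+_) (ℕP.+-comm q r)) (sym (ℕP.+-assoc k r q))) = begin
  iE * (fA * ΔH * (ikp * iD))  ≡⟨ solve 5 (λ iE fA ΔH ikp iD → iE :* (fA :* ΔH :* (ikp :* iD)) := (iE :* fA :* iD) :* ΔH :* ikp) refl iE fA ΔH ikp iD ⟩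
  (iE * fA * iD) * ΔH * ikp   ≡⟨ cong (λ t → t * ΔH * ikp) trinomial ⟩
  iB * ΔH * ikp               ≡⟨ solve 3 (λ iB ΔH ikp → iB :* ΔH :* ikp := ΔH :* (ikp :* iB)) refl iB ΔH ikp ⟩
  ΔH * (ikp * iB)             ∎
  where
  open ≡-Reasoning
  s = k ℕ.+ r ℕ.+ q
  iE = inv ((r ℕ.+ q) C q)
  fA = fromℕ ((k ℕ.+ r) C r)
  ΔH = H (k ℕ.+ r) - H r
  ikp = inv (k ^ p)
  iD = inv (s C k)
  iB = inv (s C q)
  k≤s : k ℕ.≤ s
  k≤s = subst (k ℕ.≤_) (sym (ℕP.+-assoc k r q)) (ℕP.m≤m+n k (r ℕ.+ q))
  trinomial : iE * fA * iD ≡ iB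
  trinomial = inv*fromℕ*inv≡inv ((r ℕ.+ q) C q) ((k ℕ.+ r) C r) (s C k) (s C q)
    (1≤C (ℕP.m≤n+m q r)) (1≤C k≤s) (1≤C (ℕP.m≤n+m q (k ℕ.+ r))) (C-trinomial k r q)

-- Partial fractions
altBinomialSum : ℕ → (ℕ → ℚ) → ℚ
altBinomialSum n f = sumLen 0 (suc n) (λ j → sgn j * fromℕ (n C j) * f j)

altBinomialSum-suc : ∀ n f → altBinomialSum (suc n) f ≡ altBinomialSum n f - altBinomialSum n (λ j → f (suc j))
altBinomialSum-suc n f = begin
  altBinomialSum (suc n) f
    ≡⟨ sumLen-head 0 (suc n) g ⟩
  g 0 + sumLen 1 (suc n) g
    ≡⟨ cong (g 0 +_) (trans (sumLen-suc (suc n) g) (sumLen-cong′ 0 (suc n) g-pascal)) ⟩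
  g 0 + sumLen 0 (suc n) (λ j → - h′ j + h (suc j))
    ≡⟨ cong (g 0 +_) (trans (sumLen-+ 0 (suc n) (λ j → - h′ j) (λ j → h (suc j))) (cong (_+ sumLen 0 (suc n) (λ j → h (suc j))) (sumLen-neg 0 (suc n) h′))) ⟩
  g 0 + (- altBinomialSum n (λ j → f (suc j)) + sumLen 0 (suc n) (λ j → h (suc j)))
    ≡⟨ cong (λ t → g 0 + (- altBinomialSum n (λ j → f (suc j)) + t)) h-shifted ⟩
  g 0 + (- altBinomialSum n (λ j → f (suc j)) + (altBinomialSum n f - g 0))
    ≡⟨ solve 3 (λ a b c → a :+ (:- b :+ (c :- a)) := c :- b) refl (g 0) (altBinomialSum n (λ j → f (suc j))) (altBinomialSum n f) ⟩
  altBinomialSum n f - altBinomialSum n (λ j → f (suc j)) ∎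
  where
  open ≡-Reasoning
  g = λ j → sgn j * fromℕ (suc n C j) * f j
  h = λ j → sgn j * fromℕ (n C j) * f j
  h′ = λ j → sgn j * fromℕ (n C j) * f (suc j)
  g-pascal : ∀ j → g (suc j) ≡ - h′ j + h (suc j)
  g-pascal j = trans (cong (λ t → - sgn j * fromℕ t * f (suc j)) (C-pascal n j))
    (trans (cong (λ t → - sgn j * t * f (suc j)) (fromℕ-homo-+ (n C j) (n C suc j)))
      (solve 4 (λ s a b x → (:- s) :* (a :+ b) :* x := :- (s :* a :* x) :+ (:- s) :* b :* x) refl (sgn j) (fromℕ (n C j)) (fromℕ (n C suc j)) (f (suc j))))
  h-shifted : sumLen 0 (suc n) (λ j → h (suc j)) ≡ altBinomialSum n f - g 0
  h-shifted = begin
    sumLen 0 (suc n) (λ j → h (suc j))         ≡⟨ sym (sumLen-suc (suc n) h) ⟩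
    sumLen 1 n h + h (suc n)                    ≡⟨ cong (λ t → sumLen 1 n h + sgn (suc n) * fromℕ t * f (suc n)) (ℕC.k>n⇒nCk≡0 (ℕP.n<1+n n)) ⟩
    sumLen 1 n h + sgn (suc n) * 0ℚ * f (suc n) ≡⟨ cong (λ t → sumLen 1 n h + t * f (suc n)) (ℚP.*-zeroʳ (sgn (suc n))) ⟩
    sumLen 1 n h + 0ℚ * f (suc n)               ≡⟨ trans (cong (sumLen 1 n h +_) (ℚP.*-zeroˡ (f (suc n)))) (ℚP.+-identityʳ _) ⟩
    sumLen 1 n h                                ≡⟨ solve 2 (λ a b → a := (b :+ a) :- b) refl (sumLen 1 n h) (g 0) ⟩
    (g 0 + sumLen 1 n h) - g 0                  ≡⟨ cong (_- g 0) (sym (sumLen-head 0 n h)) ⟩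
    altBinomialSum n f - g 0                    ∎

altBinomialSum-const : ∀ n c → altBinomialSum (suc n) (λ _ → c) ≡ 0ℚ
altBinomialSum-const n c = trans (altBinomialSum-suc n (λ _ → c)) (ℚP.+-inverseʳ (altBinomialSum n (λ _ → c)))

-- The Beta integral B(n + 1, x + 1).
beta : ℕ → ℕ → ℚ
beta n x = fromℕ (n !) * fromℕ (x !) * inv ((x ℕ.+ suc n) !)

beta-suc : ∀ n x → beta n x - beta n (suc x) ≡ beta (suc n) x
beta-suc n x = begin
  beta n x - beta n (suc x)
    ≡⟨ cong₂ (λ u v → fn! * fx! * iT - fn! * u * v) (fromℕ-homo-* (suc x) (x !)) (inv-homo-* S T) ⟩
  fn! * fx! * iT - fn! * (fsx * fx!) * (iS * iT)
    ≡⟨ solve 6 (λ fn! fx! iT fsx iS fsn →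
                   fn! :* fx! :* iT :- fn! :* (fsx :* fx!) :* (iS :* iT)
                := fn! :* fx! :* iT :* (con 1ℚ :- (fsx :+ fsn) :* iS) :+ fsn :* fn! :* fx! :* (iS :* iT))
         refl fn! fx! iT fsx iS fsn ⟩
  fn! * fx! * iT * (1ℚ - (fsx + fsn) * iS) + fsn * fn! * fx! * (iS * iT)
    ≡⟨ cong (λ t → fn! * fx! * iT * (1ℚ - t) + fsn * fn! * fx! * (iS * iT)) [x+1+n+1]/S≡1 ⟩
  fn! * fx! * iT * (1ℚ - 1ℚ) + fsn * fn! * fx! * (iS * iT)
    ≡⟨ solve 5 (λ fn! fx! iT iS fsn →
                   fn! :* fx! :* iT :* (con 1ℚ :- con 1ℚ) :+ fsn :* fn! :* fx! :* (iS :* iT)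
                := fsn :* fn! :* fx! :* (iS :* iT))
         refl fn! fx! iT iS fsn ⟩
  fsn * fn! * fx! * (iS * iT)
    ≡⟨ cong₂ (λ a b → a * fx! * b) (sym (fromℕ-homo-* (suc n) (n !))) (sym (trans (cong (λ t → inv (t !)) (ℕP.+-suc x (suc n))) (inv-homo-* S T))) ⟩
  beta (suc n) x ∎
  where
  open ≡-Reasoning
  S = suc (x ℕ.+ suc n)
  T = (x ℕ.+ suc n) !
  fn! = fromℕ (n !)
  fx! = fromℕ (x !)
  iT = inv T
  iS = inv S
  fsx = fromℕ (suc x)
  fsn = fromℕ (suc n)
  [x+1+n+1]/S≡1 : (fsx + fsn) * iS ≡ 1ℚ
  [x+1+n+1]/S≡1 = trans (cong (_* iS) (sym (fromℕ-homo-+ (suc x) (suc n)))) (fromℕ*inv≡1 S (ℕ.s≤s ℕ.z≤n))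

altBinomialSum-inv : ∀ n x → altBinomialSum n (λ j → inv (x ℕ.+ suc j)) ≡ beta n x
altBinomialSum-inv zero x rewrite ℕP.+-comm x 1 = begin
  0ℚ + 1ℚ * 1ℚ * inv (suc x)                  ≡⟨ solve 1 (λ a → con 0ℚ :+ con 1ℚ :* con 1ℚ :* a := a :* con 1ℚ) refl (inv (suc x)) ⟩
  inv (suc x) * 1ℚ                             ≡⟨ cong (inv (suc x) *_) (sym (fromℕ*inv≡1 (x !) (ℕP.1≤n! x))) ⟩
  inv (suc x) * (fromℕ (x !) * inv (x !))      ≡⟨ solve 3 (λ a b c → a :* (b :* c) := con 1ℚ :* b :* (a :* c)) refl (inv (suc x)) (fromℕ (x !)) (inv (x !)) ⟩
  1ℚ * fromℕ (x !) * (inv (suc x) * inv (x !)) ≡⟨ cong (1ℚ * fromℕ (x !) *_) (sym (inv-homo-* (suc x) (x !))) ⟩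
  1ℚ * fromℕ (x !) * inv (suc x !)             ∎
  where open ≡-Reasoning
altBinomialSum-inv (suc n) x = begin
  altBinomialSum (suc n) f                                ≡⟨ altBinomialSum-suc n f ⟩
  altBinomialSum n f - altBinomialSum n (λ j → f (suc j)) ≡⟨ cong₂ _-_ (altBinomialSum-inv n x) shifted ⟩
  beta n x - beta n (suc x)                               ≡⟨ beta-suc n x ⟩
  beta (suc n) x                                          ∎
  where
  open ≡-Reasoning
  f = λ j → inv (x ℕ.+ suc j)
  shifted : altBinomialSum n (λ j → f (suc j)) ≡ beta n (suc x)
  shifted = trans (sumLen-cong′ 0 (suc n) (λ j → cong (λ t → sgn j * fromℕ (n C j) * inv t) (ℕP.+-suc x (suc j))))
    (altBinomialSum-inv n (suc x))

weight : ℕ → ℕ → ℚ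
weight q a = sgn a * fromℕ (q C a) * fromℕ a

sumLen-weight : ∀ n (g : ℕ → ℚ) →
  sumLen 1 (suc n) (λ a → weight (suc n) a * g a) ≡ - (fromℕ (suc n) * altBinomialSum n (λ j → g (suc j)))
sumLen-weight n g = begin
  sumLen 1 (suc n) (λ a → weight (suc n) a * g a)
    ≡⟨ sumLen-suc (suc n) _ ⟩
  sumLen 0 (suc n) (λ j → weight (suc n) (suc j) * g (suc j))
    ≡⟨ sumLen-cong 0 (suc n) absorbed ⟩
  sumLen 0 (suc n) (λ j → - (fromℕ (suc n) * (sgn j * fromℕ (n C j) * g (suc j))))
    ≡⟨ sumLen-neg 0 (suc n) _ ⟩
  - sumLen 0 (suc n) (λ j → fromℕ (suc n) * (sgn j * fromℕ (n C j) * g (suc j)))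
    ≡⟨ cong -_ (sumLen-*ˡ 0 (suc n) (fromℕ (suc n)) _) ⟩
  - (fromℕ (suc n) * altBinomialSum n (λ j → g (suc j))) ∎
  where
  open ≡-Reasoning
  absorbed : ∀ j → j ℕ.< suc n →
    weight (suc n) (suc j) * g (suc j) ≡ - (fromℕ (suc n) * (sgn j * fromℕ (n C j) * g (suc j)))
  absorbed j (ℕ.s≤s j≤n) = begin
    - sgn j * fromℕ (suc n C suc j) * fromℕ (suc j) * g (suc j)
      ≡⟨ solve 4 (λ s a b c → (:- s) :* a :* b :* c := :- (s :* (a :* b) :* c)) refl (sgn j) (fromℕ (suc n C suc j)) (fromℕ (suc j)) (g (suc j)) ⟩
    - (sgn j * (fromℕ (suc n C suc j) * fromℕ (suc j)) * g (suc j))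
      ≡⟨ cong (λ t → - (sgn j * t * g (suc j))) C*[j+1]≡[n+1]*C ⟩
    - (sgn j * (fromℕ (suc n) * fromℕ (n C j)) * g (suc j))
      ≡⟨ cong -_ (solve 4 (λ s a b c → s :* (a :* b) :* c := a :* (s :* b :* c)) refl (sgn j) (fromℕ (suc n)) (fromℕ (n C j)) (g (suc j))) ⟩
    - (fromℕ (suc n) * (sgn j * fromℕ (n C j) * g (suc j))) ∎
    where
    C*[j+1]≡[n+1]*C : fromℕ (suc n C suc j) * fromℕ (suc j) ≡ fromℕ (suc n) * fromℕ (n C j)
    C*[j+1]≡[n+1]*C = trans (sym (fromℕ-homo-* (suc n C suc j) (suc j)))
      (trans (cong fromℕ (trans (ℕP.*-comm (suc n C suc j) (suc j)) (C-absorption n j j≤n))) (fromℕ-homo-* (suc n) (n C j)))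

sumLen-weight≡0 : ∀ n → sumLen 1 (suc (suc n)) (weight (suc (suc n))) ≡ 0ℚ
sumLen-weight≡0 n = begin
  sumLen 1 (suc (suc n)) (weight (suc (suc n)))
    ≡⟨ sumLen-cong′ 1 (suc (suc n)) (λ a → sym (ℚP.*-identityʳ _)) ⟩
  sumLen 1 (suc (suc n)) (λ a → weight (suc (suc n)) a * 1ℚ)
    ≡⟨ sumLen-weight (suc n) (λ _ → 1ℚ) ⟩
  - (fromℕ (suc (suc n)) * altBinomialSum (suc n) (λ _ → 1ℚ))
    ≡⟨ cong (λ t → - (fromℕ (suc (suc n)) * t)) (altBinomialSum-const n 1ℚ) ⟩
  - (fromℕ (suc (suc n)) * 0ℚ)
    ≡⟨ cong -_ (ℚP.*-zeroʳ (fromℕ (suc (suc n)))) ⟩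
  0ℚ ∎
  where open ≡-Reasoning

inv-C≡partialFractions : ∀ n x →
  inv ((x ℕ.+ suc n) C suc n) ≡ - sumLen 1 (suc n) (λ a → weight (suc n) a * inv (x ℕ.+ a))
inv-C≡partialFractions n x = sym (begin
  - sumLen 1 (suc n) (λ a → weight (suc n) a * inv (x ℕ.+ a))
    ≡⟨ cong -_ (sumLen-weight n (λ a → inv (x ℕ.+ a))) ⟩
  - - (fromℕ (suc n) * altBinomialSum n (λ j → inv (x ℕ.+ suc j)))
    ≡⟨ solve 1 (λ a → :- :- a := a) refl _ ⟩
  fromℕ (suc n) * altBinomialSum n (λ j → inv (x ℕ.+ suc j))
    ≡⟨ cong (fromℕ (suc n) *_) (altBinomialSum-inv n x) ⟩
  fromℕ (suc n) * (fromℕ (n !) * fromℕ (x !) * inv T)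
    ≡⟨ solve 4 (λ a b c d → a :* (b :* c :* d) := a :* b :* c :* d) refl (fromℕ (suc n)) (fromℕ (n !)) (fromℕ (x !)) (inv T) ⟩
  fromℕ (suc n) * fromℕ (n !) * fromℕ (x !) * inv T
    ≡⟨ cong (_* inv T) (sym (trans (fromℕ-homo-* (suc n !) (x !)) (cong (_* fromℕ (x !)) (fromℕ-homo-* (suc n) (n !))))) ⟩
  fromℕ (suc n ! ℕ.* x !) * inv T
    ≡⟨ fromℕ*inv-cross (suc n ! ℕ.* x !) T 1 E (ℕP.1≤n! (x ℕ.+ suc n)) (1≤C (ℕP.m≤n+m (suc n) x)) cross ⟩
  fromℕ 1 * inv E
    ≡⟨ ℚP.*-identityˡ (inv E) ⟩
  inv E ∎)
  where
  open ≡-Reasoning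
  T = (x ℕ.+ suc n) !
  E = (x ℕ.+ suc n) C suc n
  cross : (suc n ! ℕ.* x !) ℕ.* E ≡ 1 ℕ.* T
  cross = trans (ℕP.*-comm _ E) (trans
    (subst (λ t → E ℕ.* (suc n ! ℕ.* t !) ≡ T) (ℕP.m+n∸n≡m x (suc n)) (C*k!*[n∸k]!≡n! (ℕP.m≤n+m (suc n) x)))
    (sym (ℕP.*-identityˡ T)))

inv*inv-+ : ∀ c k → 1 ℕ.≤ c → 1 ℕ.≤ k → inv k * inv (k ℕ.+ c) ≡ inv c * (inv k - inv (k ℕ.+ c))
inv*inv-+ c k hc hk = sym (begin
  e * (a - b)                           ≡⟨ cong₂ (λ u v → e * (u - v)) (sym (trans (cong (a *_) b*[k+c]≡1) (ℚP.*-identityʳ a)))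
                                                                       (sym (trans (cong (b *_) a*k≡1) (ℚP.*-identityʳ b))) ⟩
  e * (a * (b * (K + Cf)) - b * (a * K)) ≡⟨ solve 5 (λ e a b K Cf → e :* (a :* (b :* (K :+ Cf)) :- b :* (a :* K)) := (a :* b) :* (e :* Cf)) refl e a b K Cf ⟩
  (a * b) * (e * Cf)                    ≡⟨ cong ((a * b) *_) (inv*fromℕ≡1 c hc) ⟩
  (a * b) * 1ℚ                          ≡⟨ ℚP.*-identityʳ _ ⟩
  a * b                                 ∎)
  where
  open ≡-Reasoning
  a = inv k
  b = inv (k ℕ.+ c)
  e = inv c
  K = fromℕ k
  Cf = fromℕ c
  a*k≡1 : a * K ≡ 1ℚ
  a*k≡1 = inv*fromℕ≡1 k hk
  b*[k+c]≡1 : b * (K + Cf) ≡ 1ℚ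
  b*[k+c]≡1 = trans (cong (b *_) (sym (fromℕ-homo-+ k c))) (inv*fromℕ≡1 (k ℕ.+ c) (ℕP.≤-trans hk (ℕP.m≤m+n k c)))

inv-^*inv-+ : ∀ p c k → 1 ℕ.≤ c → 1 ℕ.≤ k →
  inv (k ^ p) * inv (k ℕ.+ c)
    ≡ sumLen 1 p (λ m → - (sgn m * inv (c ^ m) * inv (k ^ (suc p ∸ m)))) + sgn p * inv (c ^ p) * inv (k ℕ.+ c)
inv-^*inv-+ zero c k hc hk = solve 1 (λ x → con 1ℚ :* x := con 0ℚ :+ con 1ℚ :* con 1ℚ :* x) refl (inv (k ℕ.+ c))
inv-^*inv-+ (suc p) c k hc hk = begin
  inv (k ℕ.* k ^ p) * inv (k ℕ.+ c)
    ≡⟨ cong (_* inv (k ℕ.+ c)) (trans (inv-homo-* k (k ^ p)) (ℚP.*-comm (inv k) (inv (k ^ p)))) ⟩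
  inv (k ^ p) * inv k * inv (k ℕ.+ c)
    ≡⟨ trans (ℚP.*-assoc (inv (k ^ p)) _ _) (cong (inv (k ^ p) *_) (inv*inv-+ c k hc hk)) ⟩
  inv (k ^ p) * (e * (inv k - inv (k ℕ.+ c)))
    ≡⟨ solve 4 (λ ip e ik ikc → ip :* (e :* (ik :- ikc)) := e :* (ik :* ip) :+ (:- e) :* (ip :* ikc)) refl (inv (k ^ p)) e (inv k) (inv (k ℕ.+ c)) ⟩
  e * (inv k * inv (k ^ p)) + (- e) * (inv (k ^ p) * inv (k ℕ.+ c))
    ≡⟨ cong₂ (λ u v → e * u + (- e) * v) (sym (inv-homo-* k (k ^ p))) (inv-^*inv-+ p c k hc hk) ⟩
  e * inv (k ^ suc p) + (- e) * (S + L)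
    ≡⟨ solve 4 (λ e x S L → e :* x :+ (:- e) :* (S :+ L) := e :* x :+ (:- e) :* S :+ (:- e) :* L) refl e (inv (k ^ suc p)) S L ⟩
  e * inv (k ^ suc p) + (- e) * S + (- e) * L
    ≡⟨ cong₂ _+_ (cong₂ _+_ (sym φ-1) (sym φ-rest)) (sym L-step) ⟩
  (φ 1 + sumLen 2 p φ) + sgn (suc p) * inv (c ^ suc p) * inv (k ℕ.+ c)
    ≡⟨ cong (_+ sgn (suc p) * inv (c ^ suc p) * inv (k ℕ.+ c)) (sym (sumLen-head 1 p φ)) ⟩
  sumLen 1 (suc p) φ + sgn (suc p) * inv (c ^ suc p) * inv (k ℕ.+ c) ∎
  where
  open ≡-Reasoning
  e = inv c
  ψ = λ m → - (sgn m * inv (c ^ m) * inv (k ^ (suc p ∸ m)))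
  φ = λ m → - (sgn m * inv (c ^ m) * inv (k ^ (suc (suc p) ∸ m)))
  S = sumLen 1 p ψ
  L = sgn p * inv (c ^ p) * inv (k ℕ.+ c)
  φ-1 : φ 1 ≡ e * inv (k ^ suc p)
  φ-1 = trans (cong (λ t → - (- 1ℚ * t * inv (k ^ suc p))) (cong inv (ℕP.*-identityʳ c)))
    (solve 2 (λ e x → :- (:- con 1ℚ :* e :* x) := e :* x) refl e (inv (k ^ suc p)))
  φ-suc : ∀ m → φ (m ℕ.+ 1) ≡ (- e) * ψ m
  φ-suc m rewrite ℕP.+-comm m 1 = trans (cong (λ t → - (- sgn m * t * inv (k ^ (suc p ∸ m)))) (inv-homo-* c (c ^ m)))
    (solve 4 (λ s e y x → :- ((:- s) :* (e :* y) :* x) := (:- e) :* (:- (s :* y :* x))) refl (sgn m) e (inv (c ^ m)) (inv (k ^ (suc p ∸ m))))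
  φ-rest : sumLen 2 p φ ≡ (- e) * S
  φ-rest = trans (sumLen-shift 1 1 p φ) (trans (sumLen-cong′ 1 p φ-suc) (sumLen-*ˡ 1 p (- e) ψ))
  L-step : sgn (suc p) * inv (c ^ suc p) * inv (k ℕ.+ c) ≡ (- e) * L
  L-step = trans (cong (λ t → - sgn p * t * inv (k ℕ.+ c)) (inv-homo-* c (c ^ p)))
    (solve 4 (λ s e y x → (:- s) :* (e :* y) :* x := (:- e) :* (s :* y :* x)) refl (sgn p) e (inv (c ^ p)) (inv (k ℕ.+ c)))

powerExpansion : ℕ → ℕ → ℕ → ℚ
powerExpansion p c K =
  sumLen 1 p (λ m → - (sgn m * inv (c ^ m) * zetaPartial (suc p ∸ m) K)) + sgn p * inv (c ^ p) * (H (c ℕ.+ K) - H c)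

sumLen-inv-^*inv-+ : ∀ p c K → 1 ℕ.≤ c →
  sumLen 1 K (λ k → inv (k ^ p) * inv (k ℕ.+ c)) ≡ powerExpansion p c K
sumLen-inv-^*inv-+ p c K hc = begin
  sumLen 1 K (λ k → inv (k ^ p) * inv (k ℕ.+ c))
    ≡⟨ sumLen-cong 1 K (λ j _ → inv-^*inv-+ p c (suc j) hc (ℕ.s≤s ℕ.z≤n)) ⟩
  sumLen 1 K (λ k → sumLen 1 p (ψ k) + L * inv (k ℕ.+ c))
    ≡⟨ sumLen-+ 1 K (λ k → sumLen 1 p (ψ k)) (λ k → L * inv (k ℕ.+ c)) ⟩
  sumLen 1 K (λ k → sumLen 1 p (ψ k)) + sumLen 1 K (λ k → L * inv (k ℕ.+ c))
    ≡⟨ cong₂ _+_ (sumLen-comm 1 K 1 p ψ) (sumLen-*ˡ 1 K L _) ⟩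
  sumLen 1 p (λ m → sumLen 1 K (λ k → ψ k m)) + L * sumLen 1 K (λ k → inv (k ℕ.+ c))
    ≡⟨ cong₂ _+_ (sumLen-cong′ 1 p inner) (cong (L *_) H-tail) ⟩
  powerExpansion p c K ∎
  where
  open ≡-Reasoning
  ψ = λ k m → - (sgn m * inv (c ^ m) * inv (k ^ (suc p ∸ m)))
  L = sgn p * inv (c ^ p)
  inner : ∀ m → sumLen 1 K (λ k → ψ k m) ≡ - (sgn m * inv (c ^ m) * zetaPartial (suc p ∸ m) K)
  inner m = trans (sumLen-neg 1 K _) (cong -_ (sumLen-*ˡ 1 K (sgn m * inv (c ^ m)) (λ k → inv (k ^ (suc p ∸ m)))))
  H-tail : sumLen 1 K (λ k → inv (k ℕ.+ c)) ≡ H (c ℕ.+ K) - H c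
  H-tail = sym (trans (cong (_- H c) (H-+ c K)) (solve 2 (λ a b → a :+ b :- a := b) refl (H c) _))

-- The exact identity for the truncated sums
bracket : ℕ → ℕ → ℕ → ℕ → ℚ
bracket p r a M =
  sumFT 1 (p ∸ 1) (λ m → sgn m * inv ((r ℕ.+ a) ^ m) * zetaPartial (suc p ∸ m) M)
  + sgn p * inv ((r ℕ.+ a) ^ p) * H (r ℕ.+ a)

truncationError : ℕ → ℕ → ℕ → ℕ → ℚ
truncationError p r K a =
  sumLen 1 (p ∸ 1) (λ m → sgn m * inv ((r ℕ.+ a) ^ m) * (zetaPartial (suc p ∸ m) (K ℕ.+ r) - zetaPartial (suc p ∸ m) K))
  + sgn p * inv ((r ℕ.+ a) ^ p) * (H ((r ℕ.+ a) ℕ.+ K) - H K)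

reciprocalSum : ℕ → ℕ → ℕ → ℕ → ℚ
reciprocalSum q p r K = sumLen 1 K (λ k → inv (denominator q p r k))

reciprocalSum-partialFractions : ∀ n p r K →
  reciprocalSum (suc n) p r K ≡ - sumLen 1 (suc n) (λ a → weight (suc n) a * powerExpansion p (r ℕ.+ a) K)
reciprocalSum-partialFractions n p r K = begin
  reciprocalSum q p r K
    ≡⟨ sumLen-cong′ 1 K (λ k → trans (inv-homo-* (k ^ p) _) (cong (inv (k ^ p) *_) (inv-C≡partialFractions n (k ℕ.+ r)))) ⟩
  sumLen 1 K (λ k → inv (k ^ p) * - sumLen 1 q (λ a → weight q a * inv (k ℕ.+ r ℕ.+ a)))
    ≡⟨ sumLen-cong′ 1 K distribute ⟩
  sumLen 1 K (λ k → - sumLen 1 q (λ a → weight q a * (inv (k ^ p) * inv (k ℕ.+ (r ℕ.+ a)))))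
    ≡⟨ sumLen-neg 1 K _ ⟩
  - sumLen 1 K (λ k → sumLen 1 q (λ a → weight q a * (inv (k ^ p) * inv (k ℕ.+ (r ℕ.+ a)))))
    ≡⟨ cong -_ (sumLen-comm 1 K 1 q _) ⟩
  - sumLen 1 q (λ a → sumLen 1 K (λ k → weight q a * (inv (k ^ p) * inv (k ℕ.+ (r ℕ.+ a)))))
    ≡⟨ cong -_ (sumLen-cong 1 q (λ j _ → trans (sumLen-*ˡ 1 K (weight q (suc j)) _)
         (cong (weight q (suc j) *_) (sumLen-inv-^*inv-+ p (r ℕ.+ suc j) K (ℕP.≤-trans (ℕ.s≤s ℕ.z≤n) (ℕP.m≤n+m (suc j) r)))))) ⟩
  - sumLen 1 q (λ a → weight q a * powerExpansion p (r ℕ.+ a) K) ∎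
  where
  open ≡-Reasoning
  q = suc n
  distribute : ∀ k → inv (k ^ p) * - sumLen 1 q (λ a → weight q a * inv (k ℕ.+ r ℕ.+ a))
                      ≡ - sumLen 1 q (λ a → weight q a * (inv (k ^ p) * inv (k ℕ.+ (r ℕ.+ a))))
  distribute k = trans (sym (ℚP.neg-distribʳ-* (inv (k ^ p)) _)) (cong -_ (trans (sym (sumLen-*ˡ 1 q (inv (k ^ p)) _))
    (sumLen-cong′ 1 q (λ a → trans (cong (λ t → inv (k ^ p) * (weight q a * inv t)) (ℕP.+-assoc k r a))
      (solve 3 (λ x w y → x :* (w :* y) := w :* (x :* y)) refl (inv (k ^ p)) (weight q a) (inv (k ℕ.+ (r ℕ.+ a))))))))

zetaPartial-1 : ∀ K → zetaPartial 1 K ≡ H K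
zetaPartial-1 K = sumLen-cong′ 1 K (λ k → cong inv (ℕP.*-identityʳ k))

-- The top term of the expansion involves ζ_1 = H, so it merges with the H-differences.
powerExpansion+bracket : ∀ p r K a →
  powerExpansion (suc p) (r ℕ.+ a) K + bracket (suc p) r a (K ℕ.+ r) ≡ truncationError (suc p) r K a
powerExpansion+bracket p r K a = begin
  (Sψ + ψ (suc p) + L * (HcK - Hc)) + (Sτ + L * Hc)
    ≡⟨ cong (λ t → (Sψ + t + L * (HcK - Hc)) + (Sτ + L * Hc)) last-term ⟩
  (Sψ + - (L * H K) + L * (HcK - Hc)) + (Sτ + L * Hc)
    ≡⟨ solve 6 (λ a b L h x y → (a :+ :- (L :* h) :+ L :* (x :- y)) :+ (b :+ L :* y) := (a :+ b) :+ L :* (x :- h)) refl Sψ Sτ L (H K) HcK Hc ⟩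
  (Sψ + Sτ) + L * (HcK - H K)
    ≡⟨ cong (_+ L * (HcK - H K)) (trans (sym (sumLen-+ 1 p ψ τ)) (sumLen-cong′ 1 p ψ+τ)) ⟩
  truncationError (suc p) r K a ∎
  where
  open ≡-Reasoning
  c = r ℕ.+ a
  L = sgn (suc p) * inv (c ^ suc p)
  ζ = λ m M → zetaPartial (suc (suc p) ∸ m) M
  ψ = λ m → - (sgn m * inv (c ^ m) * ζ m K)
  τ = λ m → sgn m * inv (c ^ m) * ζ m (K ℕ.+ r)
  Sψ = sumLen 1 p ψ
  Sτ = sumLen 1 p τ
  HcK = H (c ℕ.+ K)
  Hc = H c
  last-term : ψ (suc p) ≡ - (L * H K)
  last-term = cong (λ t → - (L * t)) (trans (cong (λ s → zetaPartial s K) (ℕP.m+n∸n≡m 1 (suc p))) (zetaPartial-1 K))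
  ψ+τ : ∀ m → ψ m + τ m ≡ sgn m * inv (c ^ m) * (ζ m (K ℕ.+ r) - ζ m K)
  ψ+τ m = solve 3 (λ s zK zM → :- (s :* zK) :+ s :* zM := s :* (zM :- zK)) refl (sgn m * inv (c ^ m)) (ζ m K) (ζ m (K ℕ.+ r))

powerExpansion+bracket-0 : ∀ r K a →
  powerExpansion 0 (r ℕ.+ a) K + bracket 0 r a (K ℕ.+ r) ≡ truncationError 0 r K a + H K
powerExpansion+bracket-0 r K a =
  solve 3 (λ x y h → (con 0ℚ :+ con 1ℚ :* con 1ℚ :* (x :- y)) :+ (con 0ℚ :+ con 1ℚ :* con 1ℚ :* y)
                  := (con 0ℚ :+ con 1ℚ :* con 1ℚ :* (x :- h)) :+ h) refl (H ((r ℕ.+ a) ℕ.+ K)) (H (r ℕ.+ a)) (H K)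

Σweight*[powerExpansion+bracket] : ∀ q p r K → 1 ℕ.< p ℕ.+ q →
  sumLen 1 q (λ a → weight q a * (powerExpansion p (r ℕ.+ a) K + bracket p r a (K ℕ.+ r)))
    ≡ sumLen 1 q (λ a → weight q a * truncationError p r K a)
Σweight*[powerExpansion+bracket] q (suc p) r K _ =
  sumLen-cong′ 1 q (λ a → cong (weight q a *_) (powerExpansion+bracket p r K a))
Σweight*[powerExpansion+bracket] q@(suc (suc n)) zero r K _ = begin
  sumLen 1 q (λ a → weight q a * (powerExpansion 0 (r ℕ.+ a) K + bracket 0 r a (K ℕ.+ r)))
    ≡⟨ sumLen-cong′ 1 q (λ a → trans (cong (weight q a *_) (powerExpansion+bracket-0 r K a)) (ℚP.*-distribˡ-+ (weight q a) _ _)) ⟩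
  sumLen 1 q (λ a → weight q a * truncationError 0 r K a + weight q a * H K)
    ≡⟨ sumLen-+ 1 q _ _ ⟩
  sumLen 1 q (λ a → weight q a * truncationError 0 r K a) + sumLen 1 q (λ a → weight q a * H K)
    ≡⟨ cong (sumLen 1 q (λ a → weight q a * truncationError 0 r K a) +_)
         (trans (sumLen-*ʳ 1 q (H K) (weight q)) (trans (cong (_* H K) (sumLen-weight≡0 n)) (ℚP.*-zeroˡ (H K)))) ⟩
  sumLen 1 q (λ a → weight q a * truncationError 0 r K a) + 0ℚ
    ≡⟨ ℚP.+-identityʳ _ ⟩
  sumLen 1 q (λ a → weight q a * truncationError 0 r K a) ∎
  where open ≡-Reasoning
Σweight*[powerExpansion+bracket] (suc zero) zero r K (ℕ.s≤s ())

reciprocalSum-Σweight*bracket : ∀ q p r K → 1 ℕ.≤ q → 1 ℕ.< p ℕ.+ q →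
  reciprocalSum q p r K - sumLen 1 q (λ a → weight q a * bracket p r a (K ℕ.+ r))
    ≡ - sumLen 1 q (λ a → weight q a * truncationError p r K a)
reciprocalSum-Σweight*bracket (suc n) p r K _ 1<p+q = begin
  reciprocalSum q p r K - B
    ≡⟨ cong (_- B) (reciprocalSum-partialFractions n p r K) ⟩
  - E - B
    ≡⟨ solve 2 (λ x y → :- x :- y := :- (x :+ y)) refl E B ⟩
  - (E + B)
    ≡⟨ cong -_ (trans (sym (sumLen-+ 1 q _ _)) (sumLen-cong′ 1 q (λ a → sym (ℚP.*-distribˡ-+ (weight q a) _ _)))) ⟩
  - sumLen 1 q (λ a → weight q a * (powerExpansion p (r ℕ.+ a) K + bracket p r a (K ℕ.+ r)))
    ≡⟨ cong -_ (Σweight*[powerExpansion+bracket] q p r K 1<p+q) ⟩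
  - sumLen 1 q (λ a → weight q a * truncationError p r K a) ∎
  where
  open ≡-Reasoning
  q = suc n
  E = sumLen 1 q (λ a → weight q a * powerExpansion p (r ℕ.+ a) K)
  B = sumLen 1 q (λ a → weight q a * bracket p r a (K ℕ.+ r))

lhsPartial-rhsPartial : ∀ q p r K → 1 ℕ.≤ q → 1 ℕ.< p ℕ.+ q →
  lhsPartial q p r (K ℕ.+ r) - rhsPartial q p r (K ℕ.+ r)
    ≡ H r * (- sumLen 1 q (λ a → weight q a * truncationError p r K a)) - sumLen (1 ℕ.+ K) r (reducedSummand q p r)
lhsPartial-rhsPartial q p r K 1≤q 1<p+q = begin
  lhsPartial q p r (K ℕ.+ r) - rhsPartial q p r (K ℕ.+ r)
    ≡⟨ cong₂ _-_ lhs-shifted (cong (_+ H r * B) rhs-reduced) ⟩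
  U - ((R + Tail) + H r * B)
    ≡⟨ solve 5 (λ u t T h w → u :- ((t :+ T) :+ h :* w) := (u :- t) :- h :* w :- T) refl U R Tail (H r) B ⟩
  (U - R) - H r * B - Tail
    ≡⟨ cong (λ x → x - H r * B - Tail) U-R ⟩
  H r * reciprocalSum q p r K - H r * B - Tail
    ≡⟨ cong (_- Tail) (solve 3 (λ h x y → h :* x :- h :* y := h :* (x :- y)) refl (H r) (reciprocalSum q p r K) B) ⟩
  H r * (reciprocalSum q p r K - B) - Tail
    ≡⟨ cong (λ x → H r * x - Tail) (reciprocalSum-Σweight*bracket q p r K 1≤q 1<p+q) ⟩
  H r * (- sumLen 1 q (λ a → weight q a * truncationError p r K a)) - Tail ∎
  where
  open ≡-Reasoning
  B = sumLen 1 q (λ a → weight q a * bracket p r a (K ℕ.+ r))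
  u = λ k → H (k ℕ.+ r) * inv (denominator q p r k)
  U = sumLen 1 K u
  R = sumLen 1 K (reducedSummand q p r)
  Tail = sumLen (1 ℕ.+ K) r (reducedSummand q p r)
  lhs-shifted : lhsPartial q p r (K ℕ.+ r) ≡ U
  lhs-shifted = trans (cong (λ n → sumLen (suc r) n (λ n → H n * inv (((n ∸ r) ^ p) ℕ.* ((n ℕ.+ q) C q)))) (ℕP.m+n∸n≡m K r))
    (trans (sumLen-shift 1 r K _) (sumLen-cong′ 1 K (λ k → cong (λ m → H (k ℕ.+ r) * inv ((m ^ p) ℕ.* ((k ℕ.+ r ℕ.+ q) C q))) (ℕP.m+n∸n≡m k r))))
  rhs-reduced : inv ((r ℕ.+ q) C q) * sumLen 1 (K ℕ.+ r) (λ n → hyper (suc r) n * inv ((n ^ p) ℕ.* ((n ℕ.+ q ℕ.+ r) C n)))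
                  ≡ R + Tail
  rhs-reduced = trans (sym (sumLen-*ˡ 1 (K ℕ.+ r) (inv ((r ℕ.+ q) C q)) _))
    (trans (sumLen-cong′ 1 (K ℕ.+ r) (hyperSummand≡reducedSummand q p r)) (sumLen-++ 1 K r (reducedSummand q p r)))
  U-R : U - R ≡ H r * reciprocalSum q p r K
  U-R = trans (sym (sumLen-- 1 K u (reducedSummand q p r)))
    (trans (sumLen-cong′ 1 K (λ k → solve 3 (λ a b x → a :* x :- (a :- b) :* x := b :* x) refl (H (k ℕ.+ r)) (H r) (inv (denominator q p r k))))
      (sumLen-*ˡ 1 K (H r) _))

-- Estimates
C-diagonal-suc : ∀ N q → (N ℕ.+ q) C q ℕ.≤ (N ℕ.+ suc q) C suc q
C-diagonal-suc N q = begin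
  (N ℕ.+ q) C q                           ≤⟨ ℕP.m≤m+n _ _ ⟩
  (N ℕ.+ q) C q ℕ.+ (N ℕ.+ q) C suc q     ≡⟨ sym (C-pascal (N ℕ.+ q) q) ⟩
  suc (N ℕ.+ q) C suc q                   ≡⟨ cong (λ t → t C suc q) (sym (ℕP.+-suc N q)) ⟩
  (N ℕ.+ suc q) C suc q                   ∎
  where open ℕP.≤-Reasoning

C-diagonal-mono-≤ : ∀ N {q q′} → q ℕ.≤ q′ → (N ℕ.+ q) C q ℕ.≤ (N ℕ.+ q′) C q′
C-diagonal-mono-≤ N q≤q′ = go (ℕP.≤⇒≤′ q≤q′)
  where
  go : ∀ {q q′} → q ℕ.≤′ q′ → (N ℕ.+ q) C q ℕ.≤ (N ℕ.+ q′) C q′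
  go ℕ.≤′-refl      = ℕP.≤-refl
  go (ℕ.≤′-step h) = ℕP.≤-trans (go h) (C-diagonal-suc N _)

1+N≤[N+q]Cq : ∀ N q → 1 ℕ.≤ q → suc N ℕ.≤ (N ℕ.+ q) C q
1+N≤[N+q]Cq N q 1≤q =
  subst (ℕ._≤ (N ℕ.+ q) C q) (trans (ℕC.nC1≡n (N ℕ.+ 1)) (ℕP.+-comm N 1)) (C-diagonal-mono-≤ N 1≤q)

2*[N+2]C2≡[N+2]*[N+1] : ∀ N → 2 ℕ.* ((N ℕ.+ 2) C 2) ≡ (N ℕ.+ 2) ℕ.* (N ℕ.+ 1)
2*[N+2]C2≡[N+2]*[N+1] N rewrite ℕP.+-comm N 2 | ℕP.+-comm N 1 =
  trans (C-absorption (suc N) 1 (ℕ.s≤s ℕ.z≤n)) (cong (suc (suc N) ℕ.*_) (ℕC.nC1≡n (suc N)))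

m≤m^[1+n] : ∀ m n → 1 ℕ.≤ m → m ℕ.≤ m ^ suc n
m≤m^[1+n] m@(suc _) n _ = ℕP.m≤m*n m (m ^ n) {{ℕP.m^n≢0 m n}}

1≤denominator : ∀ q p r k → 1 ℕ.≤ k → 1 ℕ.≤ denominator q p r k
1≤denominator q p r k@(suc _) _ = ℕP.*-mono-≤ (ℕP.m^n>0 k p) (1≤C (ℕP.m≤n+m q (k ℕ.+ r)))

[k+r]*[1+k]≤2*denominator : ∀ q p r k → 1 ℕ.≤ q → 1 ℕ.< p ℕ.+ q → 1 ℕ.≤ k →
  (k ℕ.+ r) ℕ.* suc k ℕ.≤ 2 ℕ.* denominator q p r k
[k+r]*[1+k]≤2*denominator q (suc p) r k 1≤q _ 1≤k = begin
  (k ℕ.+ r) ℕ.* suc k         ≤⟨ ℕP.*-mono-≤ (ℕP.n≤1+n (k ℕ.+ r)) 1+k≤2*k ⟩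
  suc (k ℕ.+ r) ℕ.* (2 ℕ.* k)  ≡⟨ ℕS.solve 2 (λ a b → a ℕS.:* (ℕS.con 2 ℕS.:* b) ℕS.:= ℕS.con 2 ℕS.:* (b ℕS.:* a)) refl (suc (k ℕ.+ r)) k ⟩
  2 ℕ.* (k ℕ.* suc (k ℕ.+ r))  ≤⟨ ℕP.*-monoʳ-≤ 2 (ℕP.*-mono-≤ (m≤m^[1+n] k p 1≤k) 1+k+r≤C) ⟩
  2 ℕ.* denominator q (suc p) r k ∎
  where
  open ℕP.≤-Reasoning
  1+k≤2*k : suc k ℕ.≤ 2 ℕ.* k
  1+k≤2*k = subst₂ ℕ._≤_ (ℕP.+-comm k 1) (cong (k ℕ.+_) (sym (ℕP.+-identityʳ k))) (ℕP.+-monoʳ-≤ k 1≤k)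
  1+k+r≤C : suc (k ℕ.+ r) ℕ.≤ (k ℕ.+ r ℕ.+ q) C q
  1+k+r≤C = 1+N≤[N+q]Cq (k ℕ.+ r) q 1≤q
[k+r]*[1+k]≤2*denominator q@(suc (suc _)) zero r k _ _ _ = begin
  (k ℕ.+ r) ℕ.* suc k           ≤⟨ ℕP.*-mono-≤ (ℕP.m≤m+n N 2) (subst (suc k ℕ.≤_) (ℕP.+-comm 1 N) (ℕ.s≤s (ℕP.m≤m+n k r))) ⟩
  (N ℕ.+ 2) ℕ.* (N ℕ.+ 1)       ≡⟨ sym (2*[N+2]C2≡[N+2]*[N+1] N) ⟩
  2 ℕ.* ((N ℕ.+ 2) C 2)         ≤⟨ ℕP.*-monoʳ-≤ 2 (C-diagonal-mono-≤ N (ℕ.s≤s (ℕ.s≤s ℕ.z≤n))) ⟩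
  2 ℕ.* ((N ℕ.+ q) C q)         ≡⟨ cong (2 ℕ.*_) (sym (ℕP.+-identityʳ ((N ℕ.+ q) C q))) ⟩
  2 ℕ.* denominator q zero r k  ∎
  where
  open ℕP.≤-Reasoning
  N = k ℕ.+ r
[k+r]*[1+k]≤2*denominator (suc zero) zero r k _ (ℕ.s≤s ()) _

0≤H[k+r]-H[r] : ∀ k r → 0ℚ ≤ H (k ℕ.+ r) - H r
0≤H[k+r]-H[r] k r = subst (0ℚ ≤_)
  (sym (trans (cong (λ t → H t - H r) (ℕP.+-comm k r)) (trans (cong (_- H r) (H-+ r k)) (solve 2 (λ a b → a :+ b :- a := b) refl (H r) _))))
  (sumLen-nonNeg 1 k _ (λ i _ → 0≤inv (1 ℕ.+ i ℕ.+ r)))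

0≤reducedSummand : ∀ q p r k → 0ℚ ≤ reducedSummand q p r k
0≤reducedSummand q p r k = 0≤* (0≤H[k+r]-H[r] k r) (0≤inv (denominator q p r k))

reducedSummand≤2/[1+k] : ∀ q p r k → 1 ℕ.≤ q → 1 ℕ.< p ℕ.+ q → 1 ℕ.≤ k →
  reducedSummand q p r k ≤ fromℕ 2 * inv (suc k)
reducedSummand≤2/[1+k] q p r k 1≤q 1<p+q 1≤k = begin
  (H (k ℕ.+ r) - H r) * inv X ≤⟨ *-mono-≤-nonNeg (0≤H[k+r]-H[r] k r) (0≤inv X) H[k+r]-H[r]≤k+r ℚP.≤-refl ⟩
  fromℕ (k ℕ.+ r) * inv X     ≤⟨ fromℕ*inv-mono-≤ (k ℕ.+ r) X 2 (suc k) (1≤denominator q p r k 1≤k) (ℕ.s≤s ℕ.z≤n)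
                                   ([k+r]*[1+k]≤2*denominator q p r k 1≤q 1<p+q 1≤k) ⟩
  fromℕ 2 * inv (suc k)       ∎
  where
  open ℚP.≤-Reasoning
  X = denominator q p r k
  H[k+r]-H[r]≤k+r : H (k ℕ.+ r) - H r ≤ fromℕ (k ℕ.+ r)
  H[k+r]-H[r]≤k+r = ℚP.≤-trans (ℚP.≤-trans (ℚP.+-monoʳ-≤ (H (k ℕ.+ r)) (ℚP.neg-antimono-≤ (0≤H r)))
    (ℚP.≤-reflexive (ℚP.+-identityʳ _))) (H≤fromℕ (k ℕ.+ r))

∣a*b*c∣≤ : ∀ a b c X → ∣ a ∣ ≤ 1ℚ → ∣ b ∣ ≤ 1ℚ → ∣ c ∣ ≤ X → ∣ a * b * c ∣ ≤ X
∣a*b*c∣≤ a b c X ∣a∣≤1 ∣b∣≤1 ∣c∣≤X = begin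
  ∣ a * b * c ∣         ≡⟨ trans (ℚP.∣p*q∣≡∣p∣*∣q∣ (a * b) c) (cong (_* ∣ c ∣) (ℚP.∣p*q∣≡∣p∣*∣q∣ a b)) ⟩
  ∣ a ∣ * ∣ b ∣ * ∣ c ∣ ≤⟨ *-mono-≤-nonNeg (0≤* (ℚP.0≤∣p∣ a) (ℚP.0≤∣p∣ b)) (ℚP.0≤∣p∣ c)
                            (*-mono-≤-nonNeg (ℚP.0≤∣p∣ a) (ℚP.0≤∣p∣ b) ∣a∣≤1 ∣b∣≤1) ∣c∣≤X ⟩
  1ℚ * 1ℚ * X           ≡⟨ solve 1 (λ x → con 1ℚ :* con 1ℚ :* x := x) refl X ⟩
  X                     ∎
  where open ℚP.≤-Reasoning

∣sumLen-tail∣≤ : ∀ K r (f : ℕ → ℚ) → (∀ k → 0ℚ ≤ f k) → (∀ j → f (1 ℕ.+ K ℕ.+ j) ≤ inv (suc K)) →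
  ∣ sumLen 1 (K ℕ.+ r) f - sumLen 1 K f ∣ ≤ fromℕ r * inv (suc K)
∣sumLen-tail∣≤ K r f 0≤f f≤ = subst (λ t → ∣ t ∣ ≤ fromℕ r * inv (suc K)) (sym tail)
  (∣sumLen∣≤length* (1 ℕ.+ K) r f (inv (suc K)) (λ j _ → subst (_≤ inv (suc K)) (sym (ℚP.0≤p⇒∣p∣≡p (0≤f _))) (f≤ j)))
  where
  tail : sumLen 1 (K ℕ.+ r) f - sumLen 1 K f ≡ sumLen (1 ℕ.+ K) r f
  tail = trans (cong (_- sumLen 1 K f) (sumLen-++ 1 K r f)) (solve 2 (λ a b → a :+ b :- a := b) refl (sumLen 1 K f) _)

inv[1+K+j]≤inv[1+K] : ∀ K j → inv (1 ℕ.+ K ℕ.+ j) ≤ inv (suc K)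
inv[1+K+j]≤inv[1+K] K j = inv-antimono-≤ (ℕ.s≤s ℕ.z≤n) (ℕ.s≤s (ℕP.m≤m+n K j))

∣zetaPartial-tail∣≤ : ∀ s K r → 1 ℕ.≤ s → ∣ zetaPartial s (K ℕ.+ r) - zetaPartial s K ∣ ≤ fromℕ r * inv (suc K)
∣zetaPartial-tail∣≤ (suc s) K r _ = ∣sumLen-tail∣≤ K r _ (λ k → 0≤inv (k ^ suc s))
  (λ j → ℚP.≤-trans (inv-antimono-≤ (ℕ.s≤s ℕ.z≤n) (m≤m^[1+n] (1 ℕ.+ K ℕ.+ j) s (ℕ.s≤s ℕ.z≤n))) (inv[1+K+j]≤inv[1+K] K j))

∣H-tail∣≤ : ∀ c K → ∣ H (c ℕ.+ K) - H K ∣ ≤ fromℕ c * inv (suc K)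
∣H-tail∣≤ c K = subst (λ t → ∣ H t - H K ∣ ≤ fromℕ c * inv (suc K)) (ℕP.+-comm K c)
  (∣sumLen-tail∣≤ K c inv 0≤inv (inv[1+K+j]≤inv[1+K] K))

truncationBound : ℕ → ℕ → ℕ → ℚ
truncationBound q p r = fromℕ p * fromℕ r + fromℕ (r ℕ.+ q)

∣truncationError∣≤ : ∀ q p r K a → a ℕ.≤ q → ∣ truncationError p r K a ∣ ≤ truncationBound q p r * inv (suc K)
∣truncationError∣≤ q p r K a a≤q = begin
  ∣ S + T ∣                                         ≤⟨ ℚP.∣p+q∣≤∣p∣+∣q∣ S T ⟩
  ∣ S ∣ + ∣ T ∣                                     ≤⟨ ℚP.+-mono-≤ ∣S∣≤ ∣T∣≤ ⟩
  fromℕ p * (fromℕ r * iK) + fromℕ (r ℕ.+ q) * iK   ≡⟨ solve 4 (λ a b c i → a :* (b :* i) :+ c :* i := (a :* b :+ c) :* i) refl (fromℕ p) (fromℕ r) (fromℕ (r ℕ.+ q)) iK ⟩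
  truncationBound q p r * iK                        ∎
  where
  open ℚP.≤-Reasoning
  iK = inv (suc K)
  c = r ℕ.+ a
  g = λ m → sgn m * inv (c ^ m) * (zetaPartial (suc p ∸ m) (K ℕ.+ r) - zetaPartial (suc p ∸ m) K)
  S = sumLen 1 (p ∸ 1) g
  T = sgn p * inv (c ^ p) * (H (c ℕ.+ K) - H K)
  ∣g∣≤ : ∀ j → j ℕ.< p ∸ 1 → ∣ g (1 ℕ.+ j) ∣ ≤ fromℕ r * iK
  ∣g∣≤ j j<p∸1 = ∣a*b*c∣≤ _ _ _ _ (ℚP.≤-reflexive (∣sgn∣≡1 (suc j))) (∣inv∣≤1 (c ^ suc j))
    (∣zetaPartial-tail∣≤ (p ∸ j) K r (ℕP.m<n⇒0<n∸m (ℕP.<-≤-trans j<p∸1 (ℕP.m∸n≤m p 1))))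
  ∣S∣≤ : ∣ S ∣ ≤ fromℕ p * (fromℕ r * iK)
  ∣S∣≤ = ℚP.≤-trans (∣sumLen∣≤length* 1 (p ∸ 1) g (fromℕ r * iK) ∣g∣≤)
    (*-mono-≤-nonNeg (0≤fromℕ (p ∸ 1)) (0≤* (0≤fromℕ r) (0≤inv (suc K))) (fromℕ-mono-≤ (ℕP.m∸n≤m p 1)) ℚP.≤-refl)
  ∣T∣≤ : ∣ T ∣ ≤ fromℕ (r ℕ.+ q) * iK
  ∣T∣≤ = ∣a*b*c∣≤ _ _ _ _ (ℚP.≤-reflexive (∣sgn∣≡1 p)) (∣inv∣≤1 (c ^ p))
    (ℚP.≤-trans (∣H-tail∣≤ c K) (*-mono-≤-nonNeg (0≤fromℕ c) (0≤inv (suc K)) (fromℕ-mono-≤ (ℕP.+-monoʳ-≤ r a≤q)) ℚP.≤-refl))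

weightMass : ℕ → ℚ
weightMass q = sumLen 1 q (λ a → ∣ weight q a ∣)

∣Σweight*truncationError∣≤ : ∀ q p r K →
  ∣ sumLen 1 q (λ a → weight q a * truncationError p r K a) ∣ ≤ weightMass q * (truncationBound q p r * inv (suc K))
∣Σweight*truncationError∣≤ q p r K = begin
  ∣ sumLen 1 q (λ a → weight q a * truncationError p r K a) ∣ ≤⟨ ∣sumLen∣≤sumLen∣∣ 1 q _ ⟩
  sumLen 1 q (λ a → ∣ weight q a * truncationError p r K a ∣) ≤⟨ sumLen-mono-≤ 1 q termwise ⟩
  sumLen 1 q (λ a → ∣ weight q a ∣ * B)                       ≡⟨ sumLen-*ʳ 1 q _ _ ⟩
  weightMass q * B                                            ∎
  where
  open ℚP.≤-Reasoning
  B = truncationBound q p r * inv (suc K)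
  termwise : ∀ j → j ℕ.< q → ∣ weight q (1 ℕ.+ j) * truncationError p r K (1 ℕ.+ j) ∣ ≤ ∣ weight q (1 ℕ.+ j) ∣ * B
  termwise j j<q = subst (_≤ ∣ weight q (suc j) ∣ * B) (sym (ℚP.∣p*q∣≡∣p∣*∣q∣ (weight q (suc j)) (truncationError p r K (suc j))))
    (*-mono-≤-nonNeg (ℚP.0≤∣p∣ (weight q (suc j))) (ℚP.0≤∣p∣ (truncationError p r K (suc j))) ℚP.≤-refl
      (∣truncationError∣≤ q p r K (suc j) j<q))

∣reducedTail∣≤ : ∀ q p r K → 1 ℕ.≤ q → 1 ℕ.< p ℕ.+ q →
  ∣ sumLen (1 ℕ.+ K) r (reducedSummand q p r) ∣ ≤ fromℕ r * (fromℕ 2 * inv (suc K))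
∣reducedTail∣≤ q p r K 1≤q 1<p+q = ∣sumLen∣≤length* (1 ℕ.+ K) r (reducedSummand q p r) _ termwise
  where
  termwise : ∀ j → j ℕ.< r → ∣ reducedSummand q p r (1 ℕ.+ K ℕ.+ j) ∣ ≤ fromℕ 2 * inv (suc K)
  termwise j _ = begin
    ∣ reducedSummand q p r k ∣ ≡⟨ ℚP.0≤p⇒∣p∣≡p (0≤reducedSummand q p r k) ⟩
    reducedSummand q p r k    ≤⟨ reducedSummand≤2/[1+k] q p r k 1≤q 1<p+q (ℕ.s≤s ℕ.z≤n) ⟩
    fromℕ 2 * inv (suc k)     ≤⟨ *-mono-≤-nonNeg (0≤fromℕ 2) (0≤inv (suc k)) ℚP.≤-refl
                                   (inv-antimono-≤ (ℕ.s≤s ℕ.z≤n) (ℕ.s≤s (ℕP.m≤n⇒m≤1+n (ℕP.m≤m+n K j)))) ⟩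
    fromℕ 2 * inv (suc K)     ∎
    where
    open ℚP.≤-Reasoning
    k = 1 ℕ.+ K ℕ.+ j

errorConstant : ℕ → ℕ → ℕ → ℚ
errorConstant q p r = H r * (weightMass q * truncationBound q p r) + fromℕ r * fromℕ 2

∣lhsPartial-rhsPartial∣≤ : ∀ q p r K → 1 ℕ.≤ q → 1 ℕ.< p ℕ.+ q →
  ∣ lhsPartial q p r (K ℕ.+ r) - rhsPartial q p r (K ℕ.+ r) ∣ ≤ errorConstant q p r * inv (suc K)
∣lhsPartial-rhsPartial∣≤ q p r K 1≤q 1<p+q = begin
  ∣ lhsPartial q p r (K ℕ.+ r) - rhsPartial q p r (K ℕ.+ r) ∣ ≡⟨ cong ∣_∣ (lhsPartial-rhsPartial q p r K 1≤q 1<p+q) ⟩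
  ∣ H r * (- S) - T ∣                                        ≤⟨ ℚP.∣p-q∣≤∣p∣+∣q∣ (H r * (- S)) T ⟩
  ∣ H r * (- S) ∣ + ∣ T ∣                                    ≡⟨ cong (_+ ∣ T ∣) (trans (ℚP.∣p*q∣≡∣p∣*∣q∣ (H r) (- S)) (cong₂ _*_ (ℚP.0≤p⇒∣p∣≡p (0≤H r)) (ℚP.∣-p∣≡∣p∣ S))) ⟩
  H r * ∣ S ∣ + ∣ T ∣                                        ≤⟨ ℚP.+-mono-≤ (*-mono-≤-nonNeg (0≤H r) (ℚP.0≤∣p∣ S) ℚP.≤-refl (∣Σweight*truncationError∣≤ q p r K))
                                                                             (∣reducedTail∣≤ q p r K 1≤q 1<p+q) ⟩
  H r * (weightMass q * (truncationBound q p r * iK)) + fromℕ r * (fromℕ 2 * iK)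
    ≡⟨ solve 6 (λ h w b i fr f2 → h :* (w :* (b :* i)) :+ fr :* (f2 :* i) := (h :* (w :* b) :+ fr :* f2) :* i) refl (H r) (weightMass q) (truncationBound q p r) iK (fromℕ r) (fromℕ 2) ⟩
  errorConstant q p r * iK ∎
  where
  open ℚP.≤-Reasoning
  iK = inv (suc K)
  S = sumLen 1 q (λ a → weight q a * truncationError p r K a)
  T = sumLen (1 ℕ.+ K) r (reducedSummand q p r)

A≤fromℕ∣↥A∣ : ∀ A → A ≤ fromℕ ℤ.∣ ℚ.↥ A ∣
A≤fromℕ∣↥A∣ (mkℚ (ℤ.+ m) d c)    rewrite fromℕ≡mkℚ m       = *≤* (ℤP.*-monoˡ-≤-nonNeg (ℤ.+ m) (ℤ.+≤+ (ℕ.s≤s ℕ.z≤n)))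
A≤fromℕ∣↥A∣ (mkℚ ℤ.-[1+ m ] d c) rewrite fromℕ≡mkℚ (suc m) = *≤* ℤ.-≤+

*inv-suc→0 : ∀ A ε → 0ℚ < ε → ∃ λ N → ∀ K → N ℕ.≤ K → A * inv (suc K) < ε
*inv-suc→0 A ε 0<ε = go ε {{ℚ.positive 0<ε}}
  where
  a = ℤ.∣ ℚ.↥ A ∣
  go : ∀ ε → .{{ℚ.Positive ε}} → ∃ λ N → ∀ K → N ℕ.≤ K → A * inv (suc K) < ε
  go (mkℚ (ℤ.+ suc e) d c) = N , λ K N≤K →
    ℚP.≤-<-trans (ℚP.*-monoʳ-≤-nonNeg (inv (suc K)) {{ℚ.nonNegative (0≤inv (suc K))}} (A≤fromℕ∣↥A∣ A))
      (ℚP.≤-<-trans (*-mono-≤-nonNeg (0≤fromℕ a) (0≤inv (suc K)) ℚP.≤-refl (inv-antimono-≤ (ℕ.s≤s ℕ.z≤n) (ℕ.s≤s N≤K)))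
        (subst₂ _<_ (sym (fromℕ*inv-suc≡/ a N)) (ℚP.normalize-coprime c) (cross⇒/< (ℤ.+ a) (ℤ.+ suc e) N d a*d<e*N)))
    where
    -- N = a (d + 1) gives a/(N + 1) < 1/(d + 1) ≤ ε.
    N = a ℕ.* suc d
    a*d<e*N : ℤ.+ a ℤ.* ℤ.+ suc d ℤ.< ℤ.+ suc e ℤ.* ℤ.+ suc N
    a*d<e*N = subst₂ ℤ._<_ (ℤP.pos-* a (suc d)) (ℤP.pos-* (suc e) (suc N))
      (ℤ.+<+ (ℕP.<-≤-trans (ℕP.n<1+n N) (ℕP.m≤n*m (suc N) (suc e))))

corollary2 : (q p r : ℕ) → 1 ℕ.≤ q → 1 ℕ.< p ℕ.+ q →
    (ε : ℚ) → 0ℚ < ε →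
    ∃ λ N → (M : ℕ) → N ℕ.≤ M →
      ∣ lhsPartial q p r M - rhsPartial q p r M ∣ < ε
corollary2 q p r 1≤q 1<p+q ε 0<ε with *inv-suc→0 (errorConstant q p r) ε 0<ε
... | N , small = N ℕ.+ r , λ M N+r≤M →
  let r≤M = ℕP.≤-trans (ℕP.m≤n+m r N) N+r≤M
      N≤M∸r = ℕP.≤-trans (ℕP.≤-reflexive (sym (ℕP.m+n∸n≡m N r))) (ℕP.∸-monoˡ-≤ r N+r≤M)
  in subst (λ t → ∣ lhsPartial q p r t - rhsPartial q p r t ∣ < ε) (ℕP.m∸n+n≡m r≤M)
       (ℚP.≤-<-trans (∣lhsPartial-rhsPartial∣≤ q p r (M ∸ r) 1≤q 1<p+q) (small (M ∸ r) N≤M∸r))
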